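{- Let $M$ be a matroid on a finite ground set $E$ with a fixed linear order $<$ on $E$, and let $\Delta_M$ be the augmented external activity complex of $M$. For any linear extension $\prec$ of the external/internal order $\le_{ext/int}$ on the set $\mathcal I(M)$ of independent sets of $M$, listing the facets $F(I)$, $I\in\mathcal I(M)$, in the order $\prec$ is a shelling order of $\Delta_M$.
   Context: Activities: for $S\subseteq E$, an element $e\in E\setminus S$ is externally active with respect to $S$ if there is a circuit $\gamma$ of $M$ with $\gamma\subseteq S\cup\{e\}$ and $e=\max\gamma$, and externally passive otherwise; $\operatorname{EA}(S)$, $\operatorname{EP}(S)$ denote the sets of externally active, resp. passive, elements (so $E\setminus S=\operatorname{EA}(S)\sqcup\operatorname{EP}(S)$). An element $i\in S$ is internally active with respect to $S$ if $i$ is externally active with respect to $E\setminus S$ in the dual matroid $M^\perp$ (with the same order), and internally passive otherwise; the sets are $\operatorname{IA}(S)$, $\operatorname{IP}(S)$. Every independent set $I$ can be written uniquely as $I=B\setminus Y$ with $B$ a basis and $Y\subseteq\operatorname{IA}(B)$; $B$ is called the basis related to $I$, and two independent sets are internally related if they have the same related basis. Order: for independent sets $I,J$, $I\le_{ext/int}J$ iff either $I,J$ are not internally related and $(I\setminus\operatorname{IA}(I))\cup\operatorname{EA}(I)\subseteq(J\setminus\operatorname{IA}(J))\cup\operatorname{EA}(J)$, or $I,J$ are internally related and $I\subseteq J$. This is a partial order on $\mathcal I(M)$. Complex: $\Delta_M$ is the simplicial complex on vertex set $\{x_e,y_e,z_e: e\in E\}$; for $S\subseteq E$ write $x_S=\{x_e:e\in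 S\}$ (similarly $y_S,z_S$) and $x_Sy_Uz_T=x_S\cup y_U\cup z_T$. Its facets are $F(I)=x_{I\cup\operatorname{EP}(I)}\,y_Y\,z_{I\cup\operatorname{EA}(I)}$, one for each independent set $I=B\setminus Y$ ($B$ the related basis, $Y\subseteq\operatorname{IA}(B)$). It is pure. Shelling: an ordering $F_1,\dots,F_s$ of the facets of a pure simplicial complex is a shelling order if for every $i<k$ there exist $j<k$ and a vertex $e\in F_k$ with $F_i\cap F_k\subseteq F_j\cap F_k=F_k\setminus\{e\}$. -}

module Defs where

open import Level using (0ℓ)
open import Data.Nat using (ℕ; _<_)
open import Data.Fin using (Fin) renaming (_≤_ to _≤ᶠ_; _<_ to _<ᶠ_)
open import Data.Fin.Subset using (Subset; _∈_; _∉_; _⊆_; _⊂_; _∪_; _─_; ⁅_⁆; ∁; ∣_∣; ⊥)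
open import Data.List using (List; length; lookup)
open import Data.List.Membership.Propositional using () renaming (_∈_ to _∈ˡ_)
open import Data.List.Relation.Unary.Unique.Propositional using (Unique)
open import Data.Product using (Σ; ∃; ∃-syntax; _×_; _,_)
open import Data.Sum using (_⊎_)
open import Relation.Nullary using (¬_; Dec)
open import Relation.Binary.PropositionalEquality using (_≡_; _≢_)

-- Ground set E = Fin n, linearly ordered by the natural order of Fin n.
-- A matroid is given by its independent sets (subsets of Fin n).
record Matroid (n : ℕ) : Set₁ where
  field
    Indep      : Subset n → Set
    Indep?     : (S : Subset n) → Dec (Indep S)
    indep-⊥    : Indep ⊥
    indep-⊆    : ∀ {I J} → I ⊆ J → Indep J → Indep I
    indep-aug  : ∀ {I J} → Indep I → Indep J → ∣ I ∣ < ∣ J ∣ →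
                 ∃[ e ] (e ∈ J × e ∉ I × Indep (I ∪ ⁅ e ⁆))
open Matroid public

module _ {n : ℕ} where

  -- everything below is parameterised by an independence predicate, so that
  -- it applies both to M and to its dual M^⊥
  IndPred : Set₁
  IndPred = Subset n → Set

  IsBasis : IndPred → Subset n → Set
  IsBasis Ind B = Ind B × (∀ S → B ⊂ S → ¬ Ind S)

  IsCircuit : IndPred → Subset n → Set
  IsCircuit Ind C = ¬ Ind C × (∀ D → D ⊂ C → Ind D)

  IsMax : Fin n → Subset n → Set
  IsMax e γ = e ∈ γ × (∀ f → f ∈ γ → f ≤ᶠ e)

  DualInd : IndPred → IndPred
  DualInd Ind S = ∃[ B ] (IsBasis Ind B × (∀ e → e ∈ S → e ∉ B))

  ExtActive : IndPred → Subset n → Fin n → Set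
  ExtActive Ind S e = e ∉ S × ∃[ γ ] (IsCircuit Ind γ × γ ⊆ (S ∪ ⁅ e ⁆) × IsMax e γ)

  ExtPassive : IndPred → Subset n → Fin n → Set
  ExtPassive Ind S e = e ∉ S × ¬ ExtActive Ind S e

  IntActive : IndPred → Subset n → Fin n → Set
  IntActive Ind S i = i ∈ S × ExtActive (DualInd Ind) (∁ S) i

  IntPassive : IndPred → Subset n → Fin n → Set
  IntPassive Ind S i = i ∈ S × ¬ IntActive Ind S i

  RelatedBasis : IndPred → Subset n → Subset n → Set
  RelatedBasis Ind I B =
    IsBasis Ind B × I ⊆ B × (∀ e → e ∈ B → e ∉ I → IntActive Ind B e)

  InternallyRelated : IndPred → Subset n → Subset n → Set
  InternallyRelated Ind I J = ∃[ B ] (RelatedBasis Ind I B × RelatedBasis Ind J B)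

  InL : IndPred → Subset n → Fin n → Set
  InL Ind I e = (e ∈ I × ¬ IntActive Ind I e) ⊎ ExtActive Ind I e

  ExtIntLe : IndPred → Subset n → Subset n → Set
  ExtIntLe Ind I J =
      (¬ InternallyRelated Ind I J × (∀ e → InL Ind I e → InL Ind J e))
    ⊎ (InternallyRelated Ind I J × I ⊆ J)

  data Vertex : Set where
    x y z : Fin n → Vertex

  Facet : IndPred → Subset n → Vertex → Set
  Facet Ind I (x e) = e ∈ I ⊎ ExtPassive Ind I e
  Facet Ind I (y e) = ∃[ B ] (RelatedBasis Ind I B × e ∈ B × e ∉ I)
  Facet Ind I (z e) = e ∈ I ⊎ ExtActive Ind I e

  EnumeratesIndep : IndPred → List (Subset n) → Set
  EnumeratesIndep Ind L = Unique L × (∀ I → (Ind I → I ∈ˡ L) × (I ∈ˡ L → Ind I))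

  IsLinearExtension : IndPred → List (Subset n) → Set
  IsLinearExtension Ind L =
    ∀ (i k : Fin (length L)) → ExtIntLe Ind (lookup L i) (lookup L k) → i ≤ᶠ k

  IsShellingOrder : List (Vertex → Set) → Set
  IsShellingOrder Fs =
    ∀ (i k : Fin (length Fs)) → i <ᶠ k →
      ∃[ j ] ∃[ v ] (j <ᶠ k × lookup Fs k v
        × (∀ w → lookup Fs i w → lookup Fs k w → lookup Fs j w)
        × (∀ w → (lookup Fs j w × lookup Fs k w) → (lookup Fs k w × w ≢ v))
        × (∀ w → (lookup Fs k w × w ≢ v) → (lookup Fs j w × lookup Fs k w)))

module Submission where

-- For independent S, an element e ∉ S is externally active iff e ∈ cl(S_{<e}), and i ∈ S is
-- internally active iff i ∉ cl((S ∖ i) ∪ E_{>i}); the basis related to I is I together with every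
-- a ∉ I outside cl(I ∪ E_{>a}).
--
-- Let I be listed before K. If K ⊆ I ∪ EA(I), then K ≤_{ext/int} I, which the linear extension forbids.
-- Otherwise some e ∈ K lies outside I ∪ EA(I), so z_e ∉ F(I), and it suffices to find an independent
-- J ≺ K with F(J) ∩ F(K) = F(K) ∖ {z_e}. Let B be the basis related to K. If EA(K) ⊆ cl(K ∖ e) and
-- e ∈ IA(B), take J = K ∖ e, which is internally related to K. Otherwise take J = (K ∖ e) ∪ f, with
-- related basis (B ∖ e) ∪ f, where f is the least element of EA(K) outside cl(K ∖ e) or, if there is
-- none, the largest f > e outside cl(B ∖ e); then EA(J) ⊆ EA(K), the passive part of J lands in
-- (K ∖ IA(K)) ∪ EA(K), and F(K) ∖ {z_e} ⊆ F(J).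

open import Defs
open import Data.Bool.Properties using () renaming (_≟_ to _≟ᵇ_)
open import Data.Empty using (⊥-elim)
open import Data.Fin using (Fin; zero; suc; cast) renaming (_≤_ to _≤ᶠ_; _<_ to _<ᶠ_)
open import Data.Fin.Induction using (<-wellFounded; >-wellFounded)
open import Data.Fin.Properties using (any?; <-cmp; toℕ-cast; cast-involutive)
  renaming (_≟_ to _≟ᶠ_; _<?_ to _<?ᶠ_; <-irrefl to <ᶠ-irrefl; <-trans to <ᶠ-trans; <⇒≢ to <ᶠ⇒≢;
            ≤∧≢⇒< to ≤∧≢⇒<ᶠ; ≤-refl to ≤ᶠ-refl)
open import Data.Fin.Subset
  using (Subset; _∈_; _∉_; _⊆_; _⊂_; _∪_; _─_; _-_; ⁅_⁆; ∁; ∣_∣; ⊥; ⊤; inside; outside)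
open import Data.Fin.Subset.Properties
  using (_∈?_; x∈p∪q⁻; x∈p∪q⁺; x∈⁅x⁆; x∈⁅y⁆⇒x≡y; p⊆q⇒∣p∣≤∣q∣; p⊂q⇒∣p∣<∣q∣; ∣p∣≤n; ∣⁅x⁆∣≡1;
         p─q⊆p; x∈p∧x≢y⇒x∈p-y; x∈p⇒∣p-x∣<∣p∣; ⊆⊤; ∉⊥; ⊆-antisym; x∈p⇒x∉∁p; x∉p⇒x∈∁p; x∈∁p⇒x∉p)
open import Data.List using (List; _∷_; length; lookup; map)
open import Data.List.Membership.Propositional using () renaming (_∈_ to _∈ˡ_)
open import Data.List.Membership.Propositional.Properties using (∈-lookup)
open import Data.List.Properties using (length-map)
import Data.List.Relation.Unary.Any as Any
open import Data.List.Relation.Unary.Any.Properties using (lookup-index)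
open import Data.Nat using (ℕ; zero; suc; _+_; z≤n; s≤s) renaming (_≤_ to _≤ₙ_; _<_ to _<ₙ_; _≤?_ to _≤?ₙ_)
open import Data.Nat.Properties
  using (+-suc; +-identityʳ; +-comm; +-monoˡ-≤; ≤-trans; m≤n⇒m≤1+n; <-≤-trans; ≤-<-trans; n≮n; ≤-pred;
         ≰⇒>; <⇒≱; ≮⇒≥; <⇒≤; m≤n+m)
open import Data.Product using (Σ; ∃-syntax; _×_; _,_; proj₁; proj₂; uncurry)
import Data.Product
open import Data.Sum using (_⊎_; inj₁; inj₂; [_,_]; [_,_]′)
import Data.Sum
open import Data.Vec using ([]; _∷_; here; there; tabulate)
open import Data.Vec.Properties using (lookup∘tabulate; []=⇒lookup; lookup⇒[]=; ≡-dec)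
open import Function using (id; _∘_)
open import Induction.WellFounded using (module All)
open import Level using (0ℓ)
open import Relation.Binary.Definitions using (tri<; tri≈; tri>)
open import Relation.Binary.PropositionalEquality using (_≡_; _≢_; refl; sym; trans; cong; subst; subst₂)
open import Relation.Nullary using (¬_; Dec; yes; no; does)
open import Relation.Nullary.Decidable using (_×-dec_; _⊎-dec_; ¬?; dec-true; decidable-stable; toSum)
open import Relation.Unary using (Decidable)

∣p∪q∣≤∣p∣+∣q∣ : ∀ {n} (p q : Subset n) → ∣ p ∪ q ∣ ≤ₙ ∣ p ∣ + ∣ q ∣
∣p∪q∣≤∣p∣+∣q∣ []            []            = z≤n
∣p∪q∣≤∣p∣+∣q∣ (outside ∷ p) (outside ∷ q) = ∣p∪q∣≤∣p∣+∣q∣ p q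
∣p∪q∣≤∣p∣+∣q∣ (inside  ∷ p) (outside ∷ q) = s≤s (∣p∪q∣≤∣p∣+∣q∣ p q)
∣p∪q∣≤∣p∣+∣q∣ (outside ∷ p) (inside  ∷ q) =
  subst (suc ∣ p ∪ q ∣ ≤ₙ_) (sym (+-suc ∣ p ∣ ∣ q ∣)) (s≤s (∣p∪q∣≤∣p∣+∣q∣ p q))
∣p∪q∣≤∣p∣+∣q∣ (inside  ∷ p) (inside  ∷ q) =
  s≤s (subst (∣ p ∪ q ∣ ≤ₙ_) (sym (+-suc ∣ p ∣ ∣ q ∣)) (m≤n⇒m≤1+n (∣p∪q∣≤∣p∣+∣q∣ p q)))

x∈p─q⇒x∉q : ∀ {n} {p q : Subset n} {x} → x ∈ p ─ q → x ∉ q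
x∈p─q⇒x∉q {p = _ ∷ p} {inside ∷ q} () here
x∈p─q⇒x∉q {p = _ ∷ p} {_ ∷ q} (there x∈p─q) (there x∈q) = x∈p─q⇒x∉q {p = p} {q} x∈p─q x∈q

module _ {n : ℕ} where

  opaque
    setOf : {P : Fin n → Set} → Decidable P → Subset n
    setOf P? = tabulate (λ u → does (P? u))

    ∈-setOf⁻ : ∀ {P : Fin n → Set} (P? : Decidable P) {u} → u ∈ setOf P? → P u
    ∈-setOf⁻ P? {u} u∈ with P? u | trans (sym (lookup∘tabulate (λ w → does (P? w)) u)) ([]=⇒lookup u∈)
    ... | yes pu | _ = pu
    ... | no _   | ()

    ∈-setOf⁺ : ∀ {P : Fin n → Set} (P? : Decidable P) {u} → P u → u ∈ setOf P?
    ∈-setOf⁺ P? {u} pu = lookup⇒[]= u _ (trans (lookup∘tabulate (λ w → does (P? w)) u) (dec-true (P? u) pu))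

  x∈p∪⁅y⁆⁻ : ∀ {p : Subset n} {u v} → u ∈ p ∪ ⁅ v ⁆ → u ∈ p ⊎ u ≡ v
  x∈p∪⁅y⁆⁻ {p} {v = v} u∈ = Data.Sum.map₂ (x∈⁅y⁆⇒x≡y v) (x∈p∪q⁻ p ⁅ v ⁆ u∈)

  p⊆p∪⁅y⁆ : ∀ {p : Subset n} {v} → p ⊆ p ∪ ⁅ v ⁆
  p⊆p∪⁅y⁆ = x∈p∪q⁺ ∘ inj₁

  y∈p∪⁅y⁆ : ∀ {p : Subset n} {v} → v ∈ p ∪ ⁅ v ⁆
  y∈p∪⁅y⁆ {v = v} = x∈p∪q⁺ (inj₂ (x∈⁅x⁆ v))

  ∪⁅⁆-monoˡ : ∀ {p q : Subset n} {v} → p ⊆ q → p ∪ ⁅ v ⁆ ⊆ q ∪ ⁅ v ⁆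
  ∪⁅⁆-monoˡ p⊆q u∈ with x∈p∪⁅y⁆⁻ u∈
  ... | inj₁ u∈p  = p⊆p∪⁅y⁆ (p⊆q u∈p)
  ... | inj₂ refl = y∈p∪⁅y⁆

  ∪⁅⁆-least : ∀ {p q : Subset n} {v} → p ⊆ q → v ∈ q → p ∪ ⁅ v ⁆ ⊆ q
  ∪⁅⁆-least p⊆q v∈q u∈ with x∈p∪⁅y⁆⁻ u∈
  ... | inj₁ u∈p  = p⊆q u∈p
  ... | inj₂ refl = v∈q

  ∪-monoʳ : ∀ {p q r : Subset n} → q ⊆ r → p ∪ q ⊆ p ∪ r
  ∪-monoʳ {p} {q} q⊆r u∈ = x∈p∪q⁺ (Data.Sum.map₂ q⊆r (x∈p∪q⁻ p q u∈))

  ∪-least : ∀ {p q r : Subset n} → p ⊆ r → q ⊆ r → p ∪ q ⊆ r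
  ∪-least {p} {q} p⊆r q⊆r u∈ = [ p⊆r , q⊆r ] (x∈p∪q⁻ p q u∈)

  ∣p∣<∣p∪⁅y⁆∣ : ∀ {p : Subset n} {v} → v ∉ p → ∣ p ∣ <ₙ ∣ p ∪ ⁅ v ⁆ ∣
  ∣p∣<∣p∪⁅y⁆∣ v∉p = p⊂q⇒∣p∣<∣q∣ (p⊆p∪⁅y⁆ , _ , y∈p∪⁅y⁆ , v∉p)

  ∣p∪⁅y⁆∣≤suc∣p∣ : ∀ (p : Subset n) v → ∣ p ∪ ⁅ v ⁆ ∣ ≤ₙ suc ∣ p ∣
  ∣p∪⁅y⁆∣≤suc∣p∣ p v =
    subst (∣ p ∪ ⁅ v ⁆ ∣ ≤ₙ_) (trans (cong (∣ p ∣ +_) (∣⁅x⁆∣≡1 v)) (+-comm ∣ p ∣ 1)) (∣p∪q∣≤∣p∣+∣q∣ p ⁅ v ⁆)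

  x∈p-y⁻ : ∀ {p : Subset n} {u v} → u ∈ p - v → u ∈ p × u ≢ v
  x∈p-y⁻ {p} {v = v} u∈ = p─q⊆p p ⁅ v ⁆ u∈ , λ { refl → x∈p─q⇒x∉q {p = p} u∈ (x∈⁅x⁆ v) }

  p⊆q⇒p-y⊆q-y : ∀ {p q : Subset n} {v} → p ⊆ q → p - v ⊆ q - v
  p⊆q⇒p-y⊆q-y p⊆q u∈ = x∈p∧x≢y⇒x∈p-y (p⊆q (proj₁ (x∈p-y⁻ u∈))) (proj₂ (x∈p-y⁻ u∈))

  p⊆p-y∪⁅y⁆ : ∀ {p : Subset n} {v} → p ⊆ (p - v) ∪ ⁅ v ⁆
  p⊆p-y∪⁅y⁆ {v = v} {u} u∈p with u ≟ᶠ v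
  ... | yes refl = y∈p∪⁅y⁆
  ... | no  u≢v  = p⊆p∪⁅y⁆ (x∈p∧x≢y⇒x∈p-y u∈p u≢v)

search-least : ∀ {n} {P : Fin n → Set} → Decidable P →
               (∀ u → ¬ P u) ⊎ Σ (Fin n) (λ u → P u × (∀ v → v <ᶠ u → ¬ P v))
search-least {zero}  P? = inj₁ (λ ())
search-least {suc n} P? with P? zero
... | yes p0 = inj₂ (zero , p0 , λ v ())
... | no ¬p0 with search-least (P? ∘ suc)
...   | inj₁ none             = inj₁ (λ { zero → ¬p0 ; (suc u) → none u })
...   | inj₂ (u , pu , least) = inj₂ (suc u , pu , λ { zero _ → ¬p0 ; (suc v) v<u → least v (≤-pred v<u) })

search-greatest : ∀ {n} {P : Fin n → Set} → Decidable P →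
                  (∀ u → ¬ P u) ⊎ Σ (Fin n) (λ u → P u × (∀ v → u <ᶠ v → ¬ P v))
search-greatest {zero}  P? = inj₁ (λ ())
search-greatest {suc n} P? with search-greatest (P? ∘ suc)
... | inj₂ (u , pu , greatest) = inj₂ (suc u , pu , λ { zero () ; (suc v) u<v → greatest v (≤-pred u<v) })
... | inj₁ none with P? zero
...   | yes p0 = inj₂ (zero , p0 , λ { zero () ; (suc v) _ → none v })
...   | no ¬p0 = inj₁ (λ { zero → ¬p0 ; (suc u) → none u })

module Circuits {n : ℕ} (P : Subset n → Set) (P? : Decidable P) (P-⊆ : ∀ {A B} → A ⊆ B → P B → P A) where

  dependent⇒⊇circuit : ∀ k D → ∣ D ∣ ≤ₙ k → ¬ P D → Σ (Subset n) λ γ → IsCircuit P γ × γ ⊆ D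
  dependent⇒⊇circuit k D ∣D∣≤k ¬PD with any? (λ f → (f ∈? D) ×-dec ¬? (P? (D - f)))
  dependent⇒⊇circuit zero D ∣D∣≤0 ¬PD | yes (f , f∈D , _) =
    ⊥-elim (n≮n 0 (<-≤-trans (≤-<-trans z≤n (x∈p⇒∣p-x∣<∣p∣ f∈D)) ∣D∣≤0))
  dependent⇒⊇circuit (suc k) D ∣D∣≤k ¬PD | yes (f , f∈D , ¬PD-f)
    with dependent⇒⊇circuit k (D - f) (≤-pred (<-≤-trans (x∈p⇒∣p-x∣<∣p∣ f∈D) ∣D∣≤k)) ¬PD-f
  ... | γ , circuit , γ⊆D-f = γ , circuit , proj₁ ∘ x∈p-y⁻ ∘ γ⊆D-f
  dependent⇒⊇circuit k D ∣D∣≤k ¬PD | no noRemovable = D , (¬PD , proper⊂-indep) , id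
    where
      proper⊂-indep : ∀ D' → D' ⊂ D → P D'
      proper⊂-indep D' (D'⊆D , g , g∈D , g∉D') =
        P-⊆ (λ u∈D' → x∈p∧x≢y⇒x∈p-y (D'⊆D u∈D') (λ { refl → g∉D' u∈D' }))
            (decidable-stable (P? (D - g)) (λ ¬PD-g → noRemovable (g , g∈D , ¬PD-g)))

  fundamental-circuit : ∀ {Z e} → P Z → ¬ P (Z ∪ ⁅ e ⁆) →
                        Σ (Subset n) λ γ → IsCircuit P γ × γ ⊆ Z ∪ ⁅ e ⁆ × e ∈ γ
  fundamental-circuit {Z} {e} PZ ¬PZe with dependent⇒⊇circuit n (Z ∪ ⁅ e ⁆) (∣p∣≤n (Z ∪ ⁅ e ⁆)) ¬PZe
  ... | γ , circuit , γ⊆Ze =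
    γ , circuit , γ⊆Ze , decidable-stable (e ∈? γ) (λ e∉γ → proj₁ circuit (P-⊆ (γ⊆Z e∉γ) PZ))
    where
      γ⊆Z : e ∉ γ → γ ⊆ Z
      γ⊆Z e∉γ u∈γ with x∈p∪⁅y⁆⁻ (γ⊆Ze u∈γ)
      ... | inj₁ u∈Z = u∈Z
      ... | inj₂ refl = ⊥-elim (e∉γ u∈γ)

  circuit-minus-indep : ∀ {γ e} → IsCircuit P γ → e ∈ γ → P (γ - e)
  circuit-minus-indep {γ} circuit e∈γ =
    proj₂ circuit _ (p─q⊆p γ _ , _ , e∈γ , λ e∈γ-e → proj₂ (x∈p-y⁻ e∈γ-e) refl)

module _ {n : ℕ} where

  ShellingStep : (FI FJ FK : Vertex {n} → Set) → Vertex {n} → Set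
  ShellingStep FI FJ FK v = FK v × (∀ w → FI w → FK w → FJ w)
                          × (∀ w → (FJ w × FK w) → (FK w × w ≢ v)) × (∀ w → (FK w × w ≢ v) → (FJ w × FK w))

  shelling-step : ∀ {FI FJ FK : Vertex {n} → Set} {v} → FK v → ¬ FI v → ¬ FJ v →
                  (∀ w → FK w → w ≢ v → FJ w) → ShellingStep FI FJ FK v
  shelling-step FKv ¬FIv ¬FJv FK-v⊆FJ =
    FKv , (λ w FIw FKw → FK-v⊆FJ w FKw λ { refl → ¬FIv FIw })
        , (λ { w (FJw , FKw) → FKw , λ { refl → ¬FJv FJw } })
        , (λ { w (FKw , w≢v) → FK-v⊆FJ w FKw w≢v , FKw })

  ShellingStep-cong : ∀ {FI FJ FK FI′ FJ′ FK′ : Vertex {n} → Set} {v} → FI ≡ FI′ → FJ ≡ FJ′ → FK ≡ FK′ →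
                      ShellingStep FI′ FJ′ FK′ v → ShellingStep FI FJ FK v
  ShellingStep-cong refl refl refl step = step

module _ {n : ℕ} {A : Set} (F : A → Vertex {n} → Set) where

  private
    lookup-map : ∀ (L : List A) i → lookup (map F L) (cast (sym (length-map F L)) i) ≡ F (lookup L i)
    lookup-map (_ ∷ L) zero    = refl
    lookup-map (_ ∷ L) (suc i) = lookup-map L i

    lookup-map′ : ∀ (L : List A) i → lookup (map F L) i ≡ F (lookup L (cast (length-map F L) i))
    lookup-map′ L i =
      trans (cong (lookup (map F L)) (sym (cast-involutive (sym (length-map F L)) (length-map F L) i)))
            (lookup-map L (cast (length-map F L) i))

  shelling-from-positions : ∀ (L : List A) →
    (∀ (i k : Fin (length L)) → i <ᶠ k →
       ∃[ j ] ∃[ v ] (j <ᶠ k × ShellingStep (F (lookup L i)) (F (lookup L j)) (F (lookup L k)) v)) →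
    IsShellingOrder (map F L)
  shelling-from-positions L steps i k i<k
    with steps (cast (length-map F L) i) (cast (length-map F L) k)
               (subst₂ _<ₙ_ (sym (toℕ-cast _ i)) (sym (toℕ-cast _ k)) i<k)
  ... | j , v , j<k , step = cast (sym (length-map F L)) j , v
                           , subst₂ _<ₙ_ (sym (toℕ-cast _ j)) (toℕ-cast _ k) j<k
                           , ShellingStep-cong (lookup-map′ L i) (lookup-map L j) (lookup-map′ L k) step

module Rank {n : ℕ} (M : Matroid n) where

  Ind : Subset n → Set
  Ind = Indep M

  Ind-⊆ : ∀ {I J} → I ⊆ J → Ind J → Ind I
  Ind-⊆ = indep-⊆ M

  ⊥⊆ : ∀ {X : Subset n} → ⊥ ⊆ X
  ⊥⊆ u∈⊥ = ⊥-elim (∉⊥ u∈⊥)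

  record MaxIndep (X Z : Subset n) : Set where
    field
      set     : Subset n
      extends : Z ⊆ set
      within  : set ⊆ X
      indep   : Ind set
      maximal : ∀ {g} → g ∈ X → g ∉ set → ¬ Ind (set ∪ ⁅ g ⁆)
  open MaxIndep public

  opaque
    greedy : ∀ k {X Z} → n ≤ₙ ∣ Z ∣ + k → Ind Z → Z ⊆ X → MaxIndep X Z
    greedy k {X} {Z} n≤ IZ Z⊆X with any? (λ g → (g ∈? X) ×-dec (¬? (g ∈? Z) ×-dec Indep? M (Z ∪ ⁅ g ⁆)))
    ... | no none = record { set = Z ; extends = id ; within = Z⊆X ; indep = IZ
                           ; maximal = λ {g} g∈X g∉Z IZg → none (g , g∈X , g∉Z , IZg) }
    greedy zero {Z = Z} n≤ IZ Z⊆X | yes (g , g∈X , g∉Z , IZg) =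
      ⊥-elim (n≮n n (≤-<-trans (subst (n ≤ₙ_) (+-identityʳ ∣ Z ∣) n≤)
                               (<-≤-trans (∣p∣<∣p∪⁅y⁆∣ g∉Z) (∣p∣≤n (Z ∪ ⁅ g ⁆)))))
    greedy (suc k) {Z = Z} n≤ IZ Z⊆X | yes (g , g∈X , g∉Z , IZg) with greedy k n≤' IZg (∪⁅⁆-least Z⊆X g∈X)
      where
        n≤' : n ≤ₙ ∣ Z ∪ ⁅ g ⁆ ∣ + k
        n≤' = ≤-trans n≤ (subst (_≤ₙ ∣ Z ∪ ⁅ g ⁆ ∣ + k) (sym (+-suc ∣ Z ∣ k)) (+-monoˡ-≤ k (∣p∣<∣p∪⁅y⁆∣ g∉Z)))
    ... | B = record { set = set B ; extends = extends B ∘ p⊆p∪⁅y⁆ ; within = within B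
                     ; indep = indep B ; maximal = maximal B }

    maxIndep : ∀ {X Z} → Ind Z → Z ⊆ X → MaxIndep X Z
    maxIndep {Z = Z} = greedy n (m≤n+m n ∣ Z ∣)

  maxIndep-of : ∀ X → MaxIndep X ⊥
  maxIndep-of X = maxIndep (indep-⊥ M) ⊥⊆

  ∣indep∣≤∣maxIndep∣ : ∀ {X Z W} (B : MaxIndep X Z) → Ind W → W ⊆ X → ∣ W ∣ ≤ₙ ∣ set B ∣
  ∣indep∣≤∣maxIndep∣ {W = W} B IW W⊆X with ∣ W ∣ ≤?ₙ ∣ set B ∣
  ... | yes ≤ = ≤
  ... | no ≰ with indep-aug M (indep B) IW (≰⇒> ≰)
  ...   | g , g∈W , g∉B , IBg = ⊥-elim (maximal B (W⊆X g∈W) g∉B IBg)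

  opaque
    rank : Subset n → ℕ
    rank X = ∣ set (maxIndep-of X) ∣

    ∣indep∣≤rank : ∀ {X W} → Ind W → W ⊆ X → ∣ W ∣ ≤ₙ rank X
    ∣indep∣≤rank = ∣indep∣≤∣maxIndep∣ (maxIndep-of _)

    rank≤∣maxIndep∣ : ∀ {X Z} (B : MaxIndep X Z) → rank X ≤ₙ ∣ set B ∣
    rank≤∣maxIndep∣ B = ∣indep∣≤∣maxIndep∣ B (indep (maxIndep-of _)) (within (maxIndep-of _))

  rank-mono : ∀ {X Y} → X ⊆ Y → rank X ≤ₙ rank Y
  rank-mono {X} X⊆Y = ≤-trans (rank≤∣maxIndep∣ B) (∣indep∣≤rank (indep B) (X⊆Y ∘ within B))
    where
      B : MaxIndep X ⊥
      B = maxIndep-of X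

  rank≤∣_∣ : ∀ X → rank X ≤ₙ ∣ X ∣
  rank≤∣ X ∣ = ≤-trans (rank≤∣maxIndep∣ (maxIndep-of X)) (p⊆q⇒∣p∣≤∣q∣ (within (maxIndep-of X)))

  rank-∪⁅⁆≤suc : ∀ X e → rank (X ∪ ⁅ e ⁆) ≤ₙ suc (rank X)
  rank-∪⁅⁆≤suc X e = ≤-trans (rank≤∣maxIndep∣ Bₑ) (≤-trans (p⊆q⇒∣p∣≤∣q∣ (p⊆p-y∪⁅y⁆ {p = B} {e}))
                      (≤-trans (∣p∪⁅y⁆∣≤suc∣p∣ (B - e) e)
                               (s≤s (∣indep∣≤rank (Ind-⊆ (p─q⊆p B _) (indep Bₑ)) B-e⊆X))))
    where
      Bₑ : MaxIndep (X ∪ ⁅ e ⁆) ⊥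
      Bₑ = maxIndep-of (X ∪ ⁅ e ⁆)
      B : Subset n
      B = set Bₑ
      B-e⊆X : B - e ⊆ X
      B-e⊆X u∈ with x∈p-y⁻ u∈
      ... | u∈B , u≢e with x∈p∪⁅y⁆⁻ (within Bₑ u∈B)
      ...   | inj₁ u∈X = u∈X
      ...   | inj₂ u≡e = ⊥-elim (u≢e u≡e)

  Cl : Subset n → Fin n → Set
  Cl X e = rank (X ∪ ⁅ e ⁆) ≤ₙ rank X

  Cl? : ∀ X e → Dec (Cl X e)
  Cl? X e = rank (X ∪ ⁅ e ⁆) ≤?ₙ rank X

  ∈⇒Cl : ∀ {X e} → e ∈ X → Cl X e
  ∈⇒Cl e∈X = rank-mono (∪⁅⁆-least id e∈X)

  indep∪⁅⁆⇒¬Cl : ∀ {I e} → Ind (I ∪ ⁅ e ⁆) → e ∉ I → ¬ Cl I e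
  indep∪⁅⁆⇒¬Cl {I} I+e e∉I cl =
    n≮n _ (≤-<-trans rank≤∣ I ∣ (<-≤-trans (∣p∣<∣p∪⁅y⁆∣ e∉I) (≤-trans (∣indep∣≤rank I+e id) cl)))

  dep∪⁅⁆⇒Cl : ∀ {I e} → Ind I → ¬ Ind (I ∪ ⁅ e ⁆) → Cl I e
  dep∪⁅⁆⇒Cl {I} {e} II ¬I+e =
    ≤-trans (rank≤∣maxIndep∣ B) (≤-trans (p⊆q⇒∣p∣≤∣q∣ B⊆I) (∣indep∣≤rank II id))
    where
      B : MaxIndep (I ∪ ⁅ e ⁆) I
      B = maxIndep {I ∪ ⁅ e ⁆} II p⊆p∪⁅y⁆
      B⊆I : set B ⊆ I
      B⊆I u∈B with x∈p∪⁅y⁆⁻ (within B u∈B)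
      ... | inj₁ u∈I = u∈I
      ... | inj₂ refl = ⊥-elim (¬I+e (Ind-⊆ (∪⁅⁆-least (extends B) u∈B) (indep B)))

  ¬Cl⇒indep∪⁅⁆ : ∀ {I e} → Ind I → ¬ Cl I e → Ind (I ∪ ⁅ e ⁆)
  ¬Cl⇒indep∪⁅⁆ II ¬cl = decidable-stable (Indep? M _) (¬cl ∘ dep∪⁅⁆⇒Cl II)

  maxIndep-spans : ∀ {X Z} (B : MaxIndep X Z) {t} → t ∈ X → Cl (set B) t
  maxIndep-spans B {t} t∈X with t ∈? set B
  ... | yes t∈B = ∈⇒Cl t∈B
  ... | no  t∉B = dep∪⁅⁆⇒Cl (indep B) (maximal B t∈X t∉B)

  ⊆Cl⇒rank≤ : ∀ {T X} → (∀ {t} → t ∈ T → Cl X t) → rank T ≤ₙ rank X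
  ⊆Cl⇒rank≤ {T} {X} T⊆clX with ∣ set (maxIndep-of T) ∣ ≤?ₙ ∣ set (maxIndep-of X) ∣
  ... | yes ≤ = ≤-trans (rank≤∣maxIndep∣ (maxIndep-of T))
                        (≤-trans ≤ (∣indep∣≤rank (indep (maxIndep-of X)) (within (maxIndep-of X))))
  ... | no ≰ with indep-aug M (indep (maxIndep-of X)) (indep (maxIndep-of T)) (≰⇒> ≰)
  ...   | g , g∈BT , g∉BX , IBX+g = ⊥-elim (
    n≮n _ (<-≤-trans (≤-<-trans (rank≤∣maxIndep∣ (maxIndep-of X)) (∣p∣<∣p∪⁅y⁆∣ g∉BX))
                     (≤-trans (∣indep∣≤rank IBX+g (∪⁅⁆-monoˡ (within (maxIndep-of X))))
                              (T⊆clX (within (maxIndep-of T) g∈BT)))))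

  Cl-mono : ∀ {X Y e} → X ⊆ Y → Cl X e → Cl Y e
  Cl-mono {X} {Y} {e} X⊆Y cl with e ∈? Y
  ... | yes e∈Y = ∈⇒Cl e∈Y
  ... | no  e∉Y = ≤-trans (⊆Cl⇒rank≤ Y+e⊆clBY) (rank-mono (within BY))
    where
      BX : MaxIndep X ⊥
      BX = maxIndep-of X
      BY : MaxIndep Y (set BX)
      BY = maxIndep {Y} (indep BX) (X⊆Y ∘ within BX)
      ¬IBY+e : ¬ Ind (set BY ∪ ⁅ e ⁆)
      ¬IBY+e IBY+e = indep∪⁅⁆⇒¬Cl (Ind-⊆ (∪⁅⁆-monoˡ (extends BY)) IBY+e) (e∉Y ∘ X⊆Y ∘ within BX)
                       (≤-trans (rank-mono (∪⁅⁆-monoˡ (within BX)))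
                                (≤-trans cl (≤-trans (rank≤∣maxIndep∣ BX) (∣indep∣≤rank (indep BX) id))))
      Y+e⊆clBY : ∀ {t} → t ∈ Y ∪ ⁅ e ⁆ → Cl (set BY) t
      Y+e⊆clBY t∈ with x∈p∪⁅y⁆⁻ t∈
      ... | inj₁ t∈Y = maxIndep-spans BY t∈Y
      ... | inj₂ refl = dep∪⁅⁆⇒Cl (indep BY) ¬IBY+e

  Cl-trans : ∀ {T X e} → (∀ {t} → t ∈ T → Cl X t) → Cl T e → Cl X e
  Cl-trans {T} {X} {e} T⊆clX cl =
    ≤-trans (rank-mono (∪⁅⁆-monoˡ (λ u∈X → x∈p∪q⁺ (inj₁ u∈X))))
            (≤-trans (Cl-mono (λ u∈T → x∈p∪q⁺ (inj₂ u∈T)) cl) (⊆Cl⇒rank≤ X∪T⊆clX))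
    where
      X∪T⊆clX : ∀ {t} → t ∈ X ∪ T → Cl X t
      X∪T⊆clX {t} t∈ with x∈p∪q⁻ X T t∈
      ... | inj₁ t∈X = ∈⇒Cl t∈X
      ... | inj₂ t∈T = T⊆clX t∈T

  Cl-exchange : ∀ {X e f} → Cl (X ∪ ⁅ f ⁆) e → ¬ Cl X e → Cl (X ∪ ⁅ e ⁆) f
  Cl-exchange {X} {e} {f} cl ¬cl =
    ≤-trans (rank-mono swap) (≤-trans cl (≤-trans (rank-∪⁅⁆≤suc X f) (≰⇒> ¬cl)))
    where
      swap : (X ∪ ⁅ e ⁆) ∪ ⁅ f ⁆ ⊆ (X ∪ ⁅ f ⁆) ∪ ⁅ e ⁆
      swap = ∪⁅⁆-least (∪⁅⁆-monoˡ p⊆p∪⁅y⁆) (p⊆p∪⁅y⁆ y∈p∪⁅y⁆)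

  indep⇒¬Cl : ∀ {X P e} → Ind X → e ∈ X → P ⊆ X - e → ¬ Cl P e
  indep⇒¬Cl IX e∈X P⊆X-e = indep∪⁅⁆⇒¬Cl (Ind-⊆ (∪⁅⁆-least (proj₁ ∘ x∈p-y⁻ ∘ P⊆X-e) e∈X) IX)
                                       (λ e∈P → proj₂ (x∈p-y⁻ (P⊆X-e e∈P)) refl)

  ¬Cl⇒indep : ∀ {X} → (∀ {e} → e ∈ X → ¬ Cl (X - e) e) → Ind X
  ¬Cl⇒indep {X} ¬cl = Ind-⊆ (λ {u} u∈X → decidable-stable (u ∈? set B) (¬spanned u∈X)) (indep B)
    where
      B : MaxIndep X ⊥
      B = maxIndep-of X
      ¬spanned : ∀ {u} → u ∈ X → ¬ ¬ (u ∈ set B)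
      ¬spanned {u} u∈X u∉B = ¬cl u∈X (Cl-mono B⊆X-u (dep∪⁅⁆⇒Cl (indep B) (maximal B u∈X u∉B)))
        where
          B⊆X-u : set B ⊆ X - u
          B⊆X-u v∈B = x∈p∧x≢y⇒x∈p-y (within B v∈B) λ { refl → u∉B v∈B }

  Spanning : Subset n → Set
  Spanning B = ∀ e → Cl B e

  basis⇒spanning : ∀ {B} → IsBasis Ind B → Spanning B
  basis⇒spanning {B} (IB , maximalB) e with e ∈? B
  ... | yes e∈B = ∈⇒Cl e∈B
  ... | no  e∉B = dep∪⁅⁆⇒Cl IB (maximalB _ (p⊆p∪⁅y⁆ , e , y∈p∪⁅y⁆ , e∉B))

  spanning⇒basis : ∀ {B} → Ind B → Spanning B → IsBasis Ind B
  spanning⇒basis IB span = IB , λ { S (B⊆S , g , g∈S , g∉B) IS →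
    indep∪⁅⁆⇒¬Cl (Ind-⊆ (∪⁅⁆-least B⊆S g∈S) IS) g∉B (span g) }

  spanning⇒full-rank : ∀ {B} → Spanning B → rank ⊤ ≤ₙ rank B
  spanning⇒full-rank span = ⊆Cl⇒rank≤ (λ {t} _ → span t)

  rank≤∣indep∣⇒spanning : ∀ {B} → Ind B → rank ⊤ ≤ₙ ∣ B ∣ → Spanning B
  rank≤∣indep∣⇒spanning IB ≤ e = ≤-trans (rank-mono ⊆⊤) (≤-trans ≤ (∣indep∣≤rank IB id))

module Activities {n : ℕ} (M : Matroid n) where

  open Rank M

  below : Subset n → Fin n → Subset n
  below S e = setOf (λ u → (u ∈? S) ×-dec (u <?ᶠ e))

  below⁻ : ∀ {S e u} → u ∈ below S e → u ∈ S × u <ᶠ e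
  below⁻ = ∈-setOf⁻ _

  below⁺ : ∀ {S e u} → u ∈ S → u <ᶠ e → u ∈ below S e
  below⁺ u∈S u<e = ∈-setOf⁺ _ (u∈S , u<e)

  below-⊆ : ∀ {S e} → below S e ⊆ S
  below-⊆ = proj₁ ∘ below⁻

  below-mono : ∀ {S T e} → S ⊆ T → below S e ⊆ below T e
  below-mono S⊆T u∈ with below⁻ u∈
  ... | u∈S , u<e = below⁺ (S⊆T u∈S) u<e

  below-monoʳ : ∀ {S e f} → e <ᶠ f → below S e ⊆ below S f
  below-monoʳ e<f u∈ with below⁻ u∈
  ... | u∈S , u<e = below⁺ u∈S (<ᶠ-trans u<e e<f)

  below⊆-self : ∀ {S e} → below S e ⊆ S - e
  below⊆-self u∈ = x∈p∧x≢y⇒x∈p-y (below-⊆ u∈) (<ᶠ⇒≢ (proj₂ (below⁻ u∈)))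

  -- (S ∖ i) ∪ {u | i < u}; i is internally active in S iff it is not spanned by this set
  restAbove : Subset n → Fin n → Subset n
  restAbove S i = setOf (λ u → ((u ∈? S) ×-dec ¬? (u ≟ᶠ i)) ⊎-dec (i <?ᶠ u))

  restAbove⁻ : ∀ {S i u} → u ∈ restAbove S i → (u ∈ S × u ≢ i) ⊎ i <ᶠ u
  restAbove⁻ = ∈-setOf⁻ _

  restAbove⁺ : ∀ {S i u} → (u ∈ S × u ≢ i) ⊎ i <ᶠ u → u ∈ restAbove S i
  restAbove⁺ = ∈-setOf⁺ _

  restAbove-mono : ∀ {S T i} → S ⊆ T → restAbove S i ⊆ restAbove T i
  restAbove-mono S⊆T = restAbove⁺ ∘ Data.Sum.map₁ (Data.Product.map₁ S⊆T) ∘ restAbove⁻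

  EA : Subset n → Fin n → Set
  EA S e = e ∉ S × Cl (below S e) e

  EA? : ∀ S e → Dec (EA S e)
  EA? S e = ¬? (e ∈? S) ×-dec Cl? (below S e) e

  IA : Subset n → Fin n → Set
  IA S i = i ∈ S × ¬ Cl (restAbove S i) i

  IA? : ∀ S i → Dec (IA S i)
  IA? S i = (i ∈? S) ×-dec ¬? (Cl? (restAbove S i) i)

  module IndCircuits = Circuits Ind (Indep? M) Ind-⊆

  ExtActive⇒EA : ∀ {S e} → Ind S → ExtActive Ind S e → EA S e
  ExtActive⇒EA {S} {e} IS (e∉S , γ , (¬Iγ , _) , γ⊆S+e , e∈γ , γ≤e) =
    e∉S , dep∪⁅⁆⇒Cl (Ind-⊆ below-⊆ IS) (¬Iγ ∘ Ind-⊆ γ⊆below+e)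
    where
      γ⊆below+e : γ ⊆ below S e ∪ ⁅ e ⁆
      γ⊆below+e {u} u∈γ with x∈p∪⁅y⁆⁻ (γ⊆S+e u∈γ)
      ... | inj₁ u∈S = p⊆p∪⁅y⁆ (below⁺ u∈S (≤∧≢⇒<ᶠ (γ≤e u u∈γ) λ { refl → e∉S u∈S }))
      ... | inj₂ refl = y∈p∪⁅y⁆

  EA⇒ExtActive : ∀ {S e} → Ind S → EA S e → ExtActive Ind S e
  EA⇒ExtActive {S} {e} IS (e∉S , cl)
    with IndCircuits.fundamental-circuit (Ind-⊆ below-⊆ IS) (λ I+e → indep∪⁅⁆⇒¬Cl I+e (e∉S ∘ below-⊆) cl)
  ... | γ , circuit , γ⊆ , e∈γ = e∉S , γ , circuit , ∪⁅⁆-monoˡ below-⊆ ∘ γ⊆ , e∈γ , γ≤e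
    where
      γ≤e : ∀ f → f ∈ γ → f ≤ᶠ e
      γ≤e f f∈γ with x∈p∪⁅y⁆⁻ (γ⊆ f∈γ)
      ... | inj₁ f∈below = <⇒≤ (proj₂ (below⁻ f∈below))
      ... | inj₂ refl = ≤ᶠ-refl

  Coindep : Subset n → Set
  Coindep = DualInd Ind

  Coindep⇒rank : ∀ {S} → Coindep S → rank ⊤ ≤ₙ rank (∁ S)
  Coindep⇒rank (B , basis , disjoint) =
    ≤-trans (spanning⇒full-rank (basis⇒spanning basis))
            (rank-mono (λ u∈B → x∉p⇒x∈∁p (λ u∈S → disjoint _ u∈S u∈B)))

  rank⇒Coindep : ∀ {S} → rank ⊤ ≤ₙ rank (∁ S) → Coindep S
  rank⇒Coindep {S} ≤ = set B
                     , spanning⇒basis (indep B) (rank≤∣indep∣⇒spanning (indep B) (≤-trans ≤ (rank≤∣maxIndep∣ B)))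
                     , λ u u∈S u∈B → x∈∁p⇒x∉p (within B u∈B) u∈S
    where
      B : MaxIndep (∁ S) ⊥
      B = maxIndep-of (∁ S)

  Coindep? : ∀ S → Dec (Coindep S)
  Coindep? S with rank ⊤ ≤?ₙ rank (∁ S)
  ... | yes ≤ = yes (rank⇒Coindep ≤)
  ... | no ≰ = no (≰ ∘ Coindep⇒rank)

  Coindep-⊆ : ∀ {A B} → A ⊆ B → Coindep B → Coindep A
  Coindep-⊆ A⊆B (B' , basis , disjoint) = B' , basis , λ u → disjoint u ∘ A⊆B

  module CoindepCircuits = Circuits Coindep Coindep? Coindep-⊆

  IntActive⇒IA : ∀ {S i} → IntActive Ind S i → IA S i
  IntActive⇒IA {S} {i} (i∈S , _ , γ , circuit , γ⊆ , i∈γ , γ≤i) =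
    i∈S , λ cl → proj₁ circuit (rank⇒Coindep (≤-trans (Coindep⇒rank γ-i-coindep) (⊆Cl⇒rank≤ (span cl))))
    where
      γ-i-coindep : Coindep (γ - i)
      γ-i-coindep = CoindepCircuits.circuit-minus-indep circuit i∈γ
      restAbove⊆∁γ : restAbove S i ⊆ ∁ γ
      restAbove⊆∁γ {u} u∈ with restAbove⁻ u∈
      ... | inj₂ i<u = x∉p⇒x∈∁p λ u∈γ → <⇒≱ i<u (γ≤i u u∈γ)
      ... | inj₁ (u∈S , u≢i) = x∉p⇒x∈∁p λ u∈γ → [ (λ u∈∁S → x∈∁p⇒x∉p u∈∁S u∈S) , u≢i ] (x∈p∪⁅y⁆⁻ (γ⊆ u∈γ))
      span : Cl (restAbove S i) i → ∀ {t} → t ∈ ∁ (γ - i) → Cl (∁ γ) t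
      span cl {t} t∈ with t ≟ᶠ i
      ... | yes refl = Cl-mono restAbove⊆∁γ cl
      ... | no t≢i = ∈⇒Cl (x∉p⇒x∈∁p λ t∈γ → x∈∁p⇒x∉p t∈ (x∈p∧x≢y⇒x∈p-y t∈γ t≢i))

  ¬Cl⇒codependent-extension : ∀ {W i} → ¬ Cl W i →
    Σ (Subset n) λ D → Coindep D × ¬ Coindep (D ∪ ⁅ i ⁆) × (∀ {u} → u ∈ D → u ∉ W × u ≢ i)
  ¬Cl⇒codependent-extension {W} {i} ¬cl = D , D-coindep , D+i-codep , proj₂ ∘ D⁻
    where
      BW : MaxIndep W ⊥
      BW = maxIndep-of W
      B : MaxIndep ⊤ (set BW ∪ ⁅ i ⁆)
      B = maxIndep {⊤} (¬Cl⇒indep∪⁅⁆ (indep BW) (¬cl ∘ Cl-mono (within BW))) ⊆⊤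
      i∈B : i ∈ set B
      i∈B = extends B y∈p∪⁅y⁆
      D : Subset n
      D = setOf (λ u → ¬? (u ∈? set B) ×-dec (¬? (u ∈? W) ×-dec ¬? (u ≟ᶠ i)))
      D⁻ : ∀ {u} → u ∈ D → u ∉ set B × u ∉ W × u ≢ i
      D⁻ = ∈-setOf⁻ _
      D-coindep : Coindep D
      D-coindep = set B , spanning⇒basis (indep B) (rank≤∣indep∣⇒spanning (indep B) (rank≤∣maxIndep∣ B))
                , λ u u∈D → proj₁ (D⁻ u∈D)
      BW⊆B-i : set BW ⊆ set B - i
      BW⊆B-i u∈BW = x∈p∧x≢y⇒x∈p-y (extends B (p⊆p∪⁅y⁆ u∈BW)) λ { refl → ¬cl (∈⇒Cl (within BW u∈BW)) }
      span : ∀ {t} → t ∈ ∁ (D ∪ ⁅ i ⁆) → Cl (set B - i) t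
      span {t} t∉ with t ≟ᶠ i | t ∈? set B | t ∈? W
      ... | yes refl | _ | _ = ⊥-elim (x∈∁p⇒x∉p t∉ y∈p∪⁅y⁆)
      ... | no t≢i | yes t∈B | _ = ∈⇒Cl (x∈p∧x≢y⇒x∈p-y t∈B t≢i)
      ... | no t≢i | no _ | yes t∈W = Cl-mono BW⊆B-i (maxIndep-spans BW t∈W)
      ... | no t≢i | no t∉B | no t∉W = ⊥-elim (x∈∁p⇒x∉p t∉ (p⊆p∪⁅y⁆ (∈-setOf⁺ _ (t∉B , t∉W , t≢i))))
      D+i-codep : ¬ Coindep (D ∪ ⁅ i ⁆)
      D+i-codep coD+i =
        n≮n _ (≤-<-trans (≤-trans (Coindep⇒rank coD+i) (≤-trans (⊆Cl⇒rank≤ span) rank≤∣ set B - i ∣))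
                         (<-≤-trans (x∈p⇒∣p-x∣<∣p∣ i∈B) (∣indep∣≤rank (indep B) ⊆⊤)))

  IA⇒IntActive : ∀ {S i} → IA S i → IntActive Ind S i
  IA⇒IntActive {S} {i} (i∈S , ¬cl) with ¬Cl⇒codependent-extension ¬cl
  ... | D , D-coindep , D+i-codep , D-outside with CoindepCircuits.fundamental-circuit D-coindep D+i-codep
  ...   | γ , circuit , γ⊆D+i , i∈γ = i∈S , x∈p⇒x∉∁p i∈S , γ , circuit , γ⊆∁S+i , i∈γ , γ≤i
    where
      γ⊆∁S+i : γ ⊆ ∁ S ∪ ⁅ i ⁆
      γ⊆∁S+i u∈γ with x∈p∪⁅y⁆⁻ (γ⊆D+i u∈γ)
      ... | inj₁ u∈D =
        p⊆p∪⁅y⁆ (x∉p⇒x∈∁p λ u∈S → proj₁ (D-outside u∈D) (restAbove⁺ (inj₁ (u∈S , proj₂ (D-outside u∈D)))))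
      ... | inj₂ refl = y∈p∪⁅y⁆
      γ≤i : ∀ f → f ∈ γ → f ≤ᶠ i
      γ≤i f f∈γ with x∈p∪⁅y⁆⁻ (γ⊆D+i f∈γ)
      ... | inj₁ f∈D = ≮⇒≥ λ i<f → proj₁ (D-outside f∈D) (restAbove⁺ (inj₂ i<f))
      ... | inj₂ refl = ≤ᶠ-refl

  RB : Subset n → Subset n → Set
  RB = RelatedBasis Ind

  private
    related-basis-⊆-at : ∀ {I B₁ B₂ u} → RB I B₁ → RB I B₂ →
                         (∀ {v} → v <ᶠ u → v ∈ B₂ → v ∈ B₁) → u ∈ B₁ → u ∈ B₂
    related-basis-⊆-at {I} {B₁} {B₂} {u} (_ , _ , B₁-I-active) (basis₂ , I⊆B₂ , _) B₂<u⊆B₁ u∈B₁ =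
      decidable-stable (u ∈? B₂) λ u∉B₂ →
        proj₂ (IntActive⇒IA (B₁-I-active u u∈B₁ (u∉B₂ ∘ I⊆B₂)))
              (Cl-mono (B₂⊆restAbove u∉B₂) (basis⇒spanning basis₂ u))
      where
        B₂⊆restAbove : u ∉ B₂ → B₂ ⊆ restAbove B₁ u
        B₂⊆restAbove u∉B₂ {v} v∈B₂ with <-cmp v u
        ... | tri< v<u _ _ = restAbove⁺ (inj₁ (B₂<u⊆B₁ v<u v∈B₂ , <ᶠ⇒≢ v<u))
        ... | tri≈ _ refl _ = ⊥-elim (u∉B₂ v∈B₂)
        ... | tri> _ _ u<v = restAbove⁺ (inj₂ u<v)

  related-basis-unique : ∀ {I B₁ B₂} → RB I B₁ → RB I B₂ → B₁ ≡ B₂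
  related-basis-unique {I} {B₁} {B₂} rb₁ rb₂ = ⊆-antisym (proj₁ (agree _)) (proj₂ (agree _))
    where
      agree : ∀ u → (u ∈ B₁ → u ∈ B₂) × (u ∈ B₂ → u ∈ B₁)
      agree = All.wfRec <-wellFounded 0ℓ _ λ u IH →
        related-basis-⊆-at rb₁ rb₂ (proj₂ ∘ IH) , related-basis-⊆-at rb₂ rb₁ (proj₁ ∘ IH)

  above : Subset n → Fin n → Subset n
  above S a = setOf (λ u → (u ∈? S) ×-dec (a <?ᶠ u))

  above⁻ : ∀ {S a u} → u ∈ above S a → u ∈ S × a <ᶠ u
  above⁻ = ∈-setOf⁻ _

  above⁺ : ∀ {S a u} → u ∈ S → a <ᶠ u → u ∈ above S a
  above⁺ u∈S a<u = ∈-setOf⁺ _ (u∈S , a<u)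

  above-mono : ∀ {S T a} → S ⊆ T → above S a ⊆ above T a
  above-mono S⊆T u∈ with above⁻ u∈
  ... | u∈S , a<u = above⁺ (S⊆T u∈S) a<u

  -- Remove the least a ∈ A and exchange it with c.
  ¬Cl-∪-ascending : ∀ k {P A c} → ∣ A ∣ ≤ₙ k → ¬ Cl P c →
                    (∀ {a} → a ∈ A → ¬ Cl ((P ∪ above A a) ∪ ⁅ c ⁆) a) → ¬ Cl (P ∪ A) c
  ¬Cl-∪-ascending k {P} {A} {c} ∣A∣≤k ¬clP fresh with search-least (_∈? A)
  ... | inj₁ A-empty = ¬clP ∘ Cl-mono (∪-least id (⊥-elim ∘ A-empty _))
  ... | inj₂ (a , a∈A , least) with k
  ...   | zero = ⊥-elim (n≮n 0 (<-≤-trans (≤-<-trans z≤n (x∈p⇒∣p-x∣<∣p∣ a∈A)) ∣A∣≤k))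
  ...   | suc k′ = λ cl →
    fresh a∈A (Cl-mono (∪⁅⁆-monoˡ (∪-monoʳ A-a⊆above)) (Cl-exchange (Cl-mono P∪A⊆ cl) ¬clP∪A-a))
    where
      ¬clP∪A-a : ¬ Cl (P ∪ (A - a)) c
      ¬clP∪A-a = ¬Cl-∪-ascending k′ (≤-pred (<-≤-trans (x∈p⇒∣p-x∣<∣p∣ a∈A) ∣A∣≤k)) ¬clP λ a′∈ →
        fresh (proj₁ (x∈p-y⁻ a′∈)) ∘ Cl-mono (∪⁅⁆-monoˡ (∪-monoʳ (above-mono (p─q⊆p A _))))
      P∪A⊆ : P ∪ A ⊆ (P ∪ (A - a)) ∪ ⁅ a ⁆
      P∪A⊆ = ∪-least (p⊆p∪⁅y⁆ ∘ x∈p∪q⁺ ∘ inj₁) (∪⁅⁆-monoˡ (x∈p∪q⁺ ∘ inj₂) ∘ p⊆p-y∪⁅y⁆)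
      A-a⊆above : A - a ⊆ above A a
      A-a⊆above u∈A-a with x∈p-y⁻ u∈A-a
      ... | u∈A , u≢a = above⁺ u∈A (≤∧≢⇒<ᶠ (≮⇒≥ λ u<a → least _ u<a u∈A) (u≢a ∘ sym))

  module RelatedBasisOf {I : Subset n} (II : Ind I) where

    added : Subset n
    added = setOf (λ a → ¬? (a ∈? I) ×-dec ¬? (Cl? (restAbove I a) a))

    basis : Subset n
    basis = I ∪ added

    added⁻ : ∀ {a} → a ∈ added → a ∉ I × ¬ Cl (restAbove I a) a
    added⁻ = ∈-setOf⁻ _

    private
      ¬Cl-I-element : ∀ {c} → c ∈ I → ¬ Cl (basis - c) c
      ¬Cl-I-element {c} c∈I = ¬Cl-∪-ascending n (∣p∣≤n added) (indep⇒¬Cl II c∈I id) fresh ∘ Cl-mono basis-c⊆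
        where
          basis-c⊆ : basis - c ⊆ (I - c) ∪ added
          basis-c⊆ u∈ with x∈p-y⁻ u∈
          ... | u∈B , u≢c =
            [ (λ u∈I → x∈p∪q⁺ (inj₁ (x∈p∧x≢y⇒x∈p-y u∈I u≢c))) , x∈p∪q⁺ ∘ inj₂ ] (x∈p∪q⁻ I added u∈B)
          fresh : ∀ {a} → a ∈ added → ¬ Cl (((I - c) ∪ above added a) ∪ ⁅ c ⁆) a
          fresh {a} a∈ = proj₂ (added⁻ a∈) ∘ Cl-mono (∪⁅⁆-least (∪-least I-c⊆ above⊆) (in-I c∈I))
            where
              in-I : ∀ {u} → u ∈ I → u ∈ restAbove I a
              in-I u∈I = restAbove⁺ (inj₁ (u∈I , λ { refl → proj₁ (added⁻ a∈) u∈I }))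
              I-c⊆ : I - c ⊆ restAbove I a
              I-c⊆ = in-I ∘ proj₁ ∘ x∈p-y⁻
              above⊆ : above added a ⊆ restAbove I a
              above⊆ = restAbove⁺ ∘ inj₂ ∘ proj₂ ∘ above⁻

    added-¬Cl : ∀ {c} → c ∈ added → ¬ Cl (restAbove basis c) c
    added-¬Cl {c} c∈ = ¬Cl-∪-ascending n (∣p∣≤n (below added c)) (proj₂ (added⁻ c∈)) fresh ∘ Cl-mono restAbove⊆
      where
        restAbove⊆ : restAbove basis c ⊆ restAbove I c ∪ below added c
        restAbove⊆ {u} u∈ with restAbove⁻ u∈
        ... | inj₂ c<u = x∈p∪q⁺ (inj₁ (restAbove⁺ (inj₂ c<u)))
        ... | inj₁ (u∈B , u≢c) with x∈p∪q⁻ I added u∈B | <-cmp u c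
        ...   | inj₁ u∈I | _ = x∈p∪q⁺ (inj₁ (restAbove⁺ (inj₁ (u∈I , u≢c))))
        ...   | inj₂ u∈A | tri< u<c _ _ = x∈p∪q⁺ (inj₂ (below⁺ u∈A u<c))
        ...   | inj₂ _   | tri≈ _ u≡c _ = ⊥-elim (u≢c u≡c)
        ...   | inj₂ _   | tri> _ _ c<u = x∈p∪q⁺ (inj₁ (restAbove⁺ (inj₂ c<u)))
        fresh : ∀ {a} → a ∈ below added c → ¬ Cl ((restAbove I c ∪ above (below added c) a) ∪ ⁅ c ⁆) a
        fresh {a} a∈ with below⁻ a∈
        ... | a∈A , a<c =
          proj₂ (added⁻ a∈A) ∘ Cl-mono (∪⁅⁆-least (∪-least restAbove-c⊆ above⊆) (restAbove⁺ (inj₂ a<c)))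
          where
            restAbove-c⊆ : restAbove I c ⊆ restAbove I a
            restAbove-c⊆ u∈ with restAbove⁻ u∈
            ... | inj₁ (u∈I , _) = restAbove⁺ (inj₁ (u∈I , λ { refl → proj₁ (added⁻ a∈A) u∈I }))
            ... | inj₂ c<u = restAbove⁺ (inj₂ (<ᶠ-trans a<c c<u))
            above⊆ : above (below added c) a ⊆ restAbove I a
            above⊆ = restAbove⁺ ∘ inj₂ ∘ proj₂ ∘ above⁻

    basis-indep : Ind basis
    basis-indep = ¬Cl⇒indep λ {c} c∈B →
      [ ¬Cl-I-element , (λ c∈A → added-¬Cl c∈A ∘ Cl-mono restAbove-of-minus) ] (x∈p∪q⁻ I added c∈B)
      where
        restAbove-of-minus : ∀ {c} → basis - c ⊆ restAbove basis c
        restAbove-of-minus = restAbove⁺ ∘ inj₁ ∘ x∈p-y⁻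

    basis-spanning : Spanning basis
    basis-spanning = All.wfRec >-wellFounded 0ℓ (Cl basis) λ g IH → spans g IH
      where
        spans : ∀ g → (∀ {h} → g <ᶠ h → Cl basis h) → Cl basis g
        spans g IH with g ∈? basis
        ... | yes g∈B = ∈⇒Cl g∈B
        ... | no g∉B = Cl-trans restAbove⊆cl (decidable-stable (Cl? _ _) λ ¬cl →
                         g∉B (x∈p∪q⁺ (inj₂ (∈-setOf⁺ _ (g∉I , ¬cl)))))
          where
            g∉I : g ∉ I
            g∉I = g∉B ∘ x∈p∪q⁺ ∘ inj₁
            restAbove⊆cl : ∀ {t} → t ∈ restAbove I g → Cl basis t
            restAbove⊆cl t∈ = [ ∈⇒Cl ∘ x∈p∪q⁺ ∘ inj₁ ∘ proj₁ , IH ] (restAbove⁻ t∈)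

    related : RB I basis
    related = spanning⇒basis basis-indep basis-spanning , x∈p∪q⁺ ∘ inj₁
            , λ e e∈B e∉I →
                IA⇒IntActive (e∈B , added-¬Cl ([ (λ e∈I → ⊥-elim (e∉I e∈I)) , id ] (x∈p∪q⁻ I added e∈B)))

  related-basis : ∀ {I} → Ind I → Σ (Subset n) (RB I)
  related-basis II = RelatedBasisOf.basis II , RelatedBasisOf.related II

module Shelling {n : ℕ} (M : Matroid n) where

  open Rank M
  open Activities M

  Facet-x⁻ : ∀ {K g} → Ind K → Facet Ind K (x g) → g ∈ K ⊎ (g ∉ K × ¬ EA K g)
  Facet-x⁻ IK (inj₁ g∈K)         = inj₁ g∈K
  Facet-x⁻ IK (inj₂ (g∉K , ¬ea)) = inj₂ (g∉K , ¬ea ∘ EA⇒ExtActive IK)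

  Facet-x⁺ : ∀ {K g} → Ind K → g ∈ K ⊎ (g ∉ K × ¬ EA K g) → Facet Ind K (x g)
  Facet-x⁺ IK (inj₁ g∈K)         = inj₁ g∈K
  Facet-x⁺ IK (inj₂ (g∉K , ¬ea)) = inj₂ (g∉K , ¬ea ∘ ExtActive⇒EA IK)

  Facet-z⁻ : ∀ {K g} → Ind K → Facet Ind K (z g) → g ∈ K ⊎ EA K g
  Facet-z⁻ IK = Data.Sum.map₂ (ExtActive⇒EA IK)

  Facet-z⁺ : ∀ {K g} → Ind K → g ∈ K ⊎ EA K g → Facet Ind K (z g)
  Facet-z⁺ IK = Data.Sum.map₂ (EA⇒ExtActive IK)

  Facet-y⁻ : ∀ {K B g} → RB K B → Facet Ind K (y g) → g ∈ B × g ∉ K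
  Facet-y⁻ rb (B′ , rb′ , g∈B′ , g∉K) = subst (_ ∈_) (related-basis-unique rb′ rb) g∈B′ , g∉K

  Facet-y⁺ : ∀ {K B g} → RB K B → g ∈ B → g ∉ K → Facet Ind K (y g)
  Facet-y⁺ rb g∈B g∉K = _ , rb , g∈B , g∉K

  InL⁻ : ∀ {K g} → Ind K → InL Ind K g → (g ∈ K × Cl (restAbove K g) g) ⊎ EA K g
  InL⁻ IK (inj₁ (g∈K , ¬ia)) = inj₁ (g∈K , decidable-stable (Cl? _ _) (¬ia ∘ IA⇒IntActive ∘ (g∈K ,_)))
  InL⁻ IK (inj₂ ea)          = inj₂ (ExtActive⇒EA IK ea)

  InL⁺ : ∀ {K g} → Ind K → (g ∈ K × Cl (restAbove K g) g) ⊎ EA K g → InL Ind K g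
  InL⁺ IK (inj₁ (g∈K , cl)) = inj₁ (g∈K , λ ia → proj₂ (IntActive⇒IA ia) cl)
  InL⁺ IK (inj₂ ea)         = inj₂ (EA⇒ExtActive IK ea)

  ∈⇒¬Cl-below : ∀ {I e} → Ind I → e ∈ I → ¬ Cl (below I e) e
  ∈⇒¬Cl-below II e∈I = indep⇒¬Cl II e∈I below⊆-self

  EA-below-Cl : ∀ {I t e} → EA I t → t <ᶠ e → Cl (below I e) t
  EA-below-Cl (_ , cl) t<e = Cl-mono (below-monoʳ t<e) cl

  module _ {I K : Subset n} (II : Ind I) (K⊆I∪EA : ∀ {e} → e ∈ K → e ∈ I ⊎ EA I e) where

    EA-of-⊆∪EA : ∀ {e} → EA K e → EA I e
    EA-of-⊆∪EA {e} (_ , cl) = (λ e∈I → ∈⇒¬Cl-below II e∈I clI) , clI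
      where
        clI : Cl (below I e) e
        clI = Cl-trans (λ t∈ → [ (λ t∈I → ∈⇒Cl (below⁺ t∈I (proj₂ (below⁻ t∈))))
                               , (λ ea → EA-below-Cl ea (proj₂ (below⁻ t∈))) ] (K⊆I∪EA (below-⊆ t∈))) cl

    passive-of-⊆∪EA : ∀ {e} → e ∈ I → Cl (restAbove K e) e → Cl (restAbove I e) e
    passive-of-⊆∪EA {e} e∈I = Cl-trans span
      where
        span : ∀ {t} → t ∈ restAbove K e → Cl (restAbove I e) t
        span t∈ with restAbove⁻ t∈
        ... | inj₂ e<t = ∈⇒Cl (restAbove⁺ (inj₂ e<t))
        ... | inj₁ (t∈K , t≢e) with K⊆I∪EA t∈K | <-cmp _ e
        ...   | inj₁ t∈I | _ = ∈⇒Cl (restAbove⁺ (inj₁ (t∈I , t≢e)))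
        ...   | inj₂ _ | tri≈ _ t≡e _ = ⊥-elim (t≢e t≡e)
        ...   | inj₂ _ | tri> _ _ e<t = ∈⇒Cl (restAbove⁺ (inj₂ e<t))
        ...   | inj₂ ea | tri< t<e _ _ =
          Cl-mono (λ u∈ → restAbove⁺ (inj₁ (below-⊆ u∈ , <ᶠ⇒≢ (<ᶠ-trans (proj₂ (below⁻ u∈)) t<e)))) (proj₂ ea)

    InL-of-⊆∪EA : Ind K → ∀ e → InL Ind K e → InL Ind I e
    InL-of-⊆∪EA IK e inL with InL⁻ IK inL
    ... | inj₂ ea = InL⁺ II (inj₂ (EA-of-⊆∪EA ea))
    ... | inj₁ (e∈K , cl) with K⊆I∪EA e∈K
    ...   | inj₁ e∈I = InL⁺ II (inj₁ (e∈I , passive-of-⊆∪EA e∈I cl))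
    ...   | inj₂ ea  = InL⁺ II (inj₂ ea)

    common-related-basis⇒⊆ : ∀ {B} → RB K B → RB I B → K ⊆ I
    common-related-basis⇒⊆ (basis , K⊆B , _) (_ , I⊆B , _) {e} e∈K with K⊆I∪EA e∈K
    ... | inj₁ e∈I = e∈I
    ... | inj₂ (_ , cl) = ⊥-elim (∈⇒¬Cl-below (proj₁ basis) (K⊆B e∈K) (Cl-mono (below-mono I⊆B) cl))

    ⊆∪EA⇒ExtIntLe : Ind K → ExtIntLe Ind K I
    ⊆∪EA⇒ExtIntLe IK = compare (related-basis IK) (related-basis II)
      where
        compare : Σ (Subset n) (RB K) → Σ (Subset n) (RB I) → ExtIntLe Ind K I
        compare (BK , rbK) (BI , rbI) with ≡-dec _≟ᵇ_ BK BI
        ... | yes refl = inj₂ ((BK , rbK , rbI) , common-related-basis⇒⊆ rbK rbI)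
        ... | no BK≢BI = inj₁ (not-related , InL-of-⊆∪EA IK)
          where
            not-related : ¬ InternallyRelated Ind K I
            not-related (_ , rbK′ , rbI′) =
              BK≢BI (trans (related-basis-unique rbK rbK′) (related-basis-unique rbI′ rbI))

  record Ridge (K : Subset n) (e : Fin n) : Set where
    field
      J       : Subset n
      J-indep : Ind J
      J≢K     : J ≢ K
      J≤K     : ExtIntLe Ind J K
      z∉FJ    : ¬ Facet Ind J (z e)
      FK⊆FJ   : ∀ w → Facet Ind K w → w ≢ z e → Facet Ind J w

  module RidgeAt {K : Subset n} (IK : Ind K) {e : Fin n} (e∈K : e ∈ K) {B : Subset n} (rbK : RB K B) where

    B-basis : IsBasis Ind B
    B-basis = proj₁ rbK

    K⊆B : K ⊆ B
    K⊆B = proj₁ (proj₂ rbK)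

    B-spanning : Spanning B
    B-spanning = basis⇒spanning B-basis

    ¬Cl-K-e : ¬ Cl (K - e) e
    ¬Cl-K-e = indep⇒¬Cl IK e∈K id

    ¬Cl-B-e : ¬ Cl (B - e) e
    ¬Cl-B-e = indep⇒¬Cl (proj₁ B-basis) (K⊆B e∈K) id

    ¬EA-at-e : ∀ {J} → (∀ {u} → u ∈ J → u <ᶠ e → u ∈ K) → ¬ EA J e
    ¬EA-at-e {J} J<e⊆K (_ , cl) = ¬Cl-K-e (Cl-mono (below⊆-self ∘ below-J⊆below-K) cl)
      where
        below-J⊆below-K : below J e ⊆ below K e
        below-J⊆below-K u∈ = below⁺ (J<e⊆K (below-⊆ u∈) (proj₂ (below⁻ u∈))) (proj₂ (below⁻ u∈))

    EA-outside-K : ∀ {J g} → (∀ {u} → u ∈ K → u ≢ e → u ∈ J) → (∀ {u} → u ∈ J → u <ᶠ e → u ∈ K) →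
                   EA J g → g ∉ K
    EA-outside-K {g = g} K-e⊆J J<e⊆K ea@(g∉J , _) g∈K with g ≟ᶠ e
    ... | yes refl = ¬EA-at-e J<e⊆K ea
    ... | no g≢e = g∉J (K-e⊆J g∈K g≢e)

    record RidgeData : Set where
      field
        J B′        : Subset n
        J-indep     : Ind J
        rbJ         : RB J B′
        J≢K         : J ≢ K
        J≤K         : ExtIntLe Ind J K
        K-e⊆J       : ∀ {g} → g ∈ K → g ≢ e → g ∈ J
        e∉J         : e ∉ J
        J<e⊆K       : ∀ {u} → u ∈ J → u <ᶠ e → u ∈ K
        EA-J⊆EA-K   : ∀ {g} → EA J g → EA K g
        EA-K⊆J∪EA-J : ∀ {g} → EA K g → g ∈ J ⊎ EA J g
        B-K⊆B′-J    : ∀ {g} → g ∈ B → g ∉ K → g ∈ B′ × g ∉ J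

    ridge-from : RidgeData → Ridge K e
    ridge-from c = record { J = J ; J-indep = J-indep ; J≢K = J≢K ; J≤K = J≤K ; z∉FJ = z∉FJ ; FK⊆FJ = FK⊆FJ }
      where
        open RidgeData c
        ¬EA-J-e : ¬ EA J e
        ¬EA-J-e = ¬EA-at-e J<e⊆K
        z∉FJ : ¬ Facet Ind J (z e)
        z∉FJ = [ e∉J , ¬EA-J-e ] ∘ Facet-z⁻ J-indep
        FK⊆FJ : ∀ w → Facet Ind K w → w ≢ z e → Facet Ind J w
        FK⊆FJ (x g) inF _ with Facet-x⁻ IK inF | g ≟ᶠ e
        ... | inj₁ _ | yes refl = Facet-x⁺ J-indep (inj₂ (e∉J , ¬EA-J-e))
        ... | inj₁ g∈K | no g≢e = inj₁ (K-e⊆J g∈K g≢e)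
        ... | inj₂ (g∉K , ¬ea) | _ with g ∈? J
        ...   | yes g∈J = inj₁ g∈J
        ...   | no g∉J = Facet-x⁺ J-indep (inj₂ (g∉J , ¬ea ∘ EA-J⊆EA-K))
        FK⊆FJ (y g) inF _ with Facet-y⁻ rbK inF
        ... | g∈B , g∉K = Facet-y⁺ rbJ (proj₁ (B-K⊆B′-J g∈B g∉K)) (proj₂ (B-K⊆B′-J g∈B g∉K))
        FK⊆FJ (z g) inF z≢ =
          Facet-z⁺ J-indep ([ (λ g∈K → inj₁ (K-e⊆J g∈K λ { refl → z≢ refl })) , EA-K⊆J∪EA-J ] (Facet-z⁻ IK inF))

    private
      below-e-Cl : ∀ {g} → Cl (below K g) g → Cl (K - e) g → Cl (below K g - e) g
      below-e-Cl {g} cl cl-K-e = decidable-stable (Cl? _ _) λ ¬cl →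
        ¬Cl-K-e (Cl-trans span (Cl-exchange (Cl-mono p⊆p-y∪⁅y⁆ cl) ¬cl))
        where
          span : ∀ {t} → t ∈ (below K g - e) ∪ ⁅ g ⁆ → Cl (K - e) t
          span t∈ with x∈p∪⁅y⁆⁻ t∈
          ... | inj₁ t∈ = ∈⇒Cl (p⊆q⇒p-y⊆q-y below-⊆ t∈)
          ... | inj₂ refl = cl-K-e

    EA-survives : ∀ {J g} → (∀ {u} → u ∈ K → u ≢ e → u ∈ J) → EA K g → Cl (K - e) g → g ∈ J ⊎ EA J g
    EA-survives {J} {g} K-e⊆J (_ , cl) cl-K-e with g ∈? J
    ... | yes g∈J = inj₁ g∈J
    ... | no g∉J = inj₂ (g∉J , Cl-mono below-e⊆ (below-e-Cl cl cl-K-e))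
      where
        below-e⊆ : below K g - e ⊆ below J g
        below-e⊆ u∈ with x∈p-y⁻ u∈
        ... | u∈below , u≢e = below⁺ (K-e⊆J (below-⊆ u∈below) u≢e) (proj₂ (below⁻ u∈below))

    case-remove : (∀ {g} → EA K g → Cl (K - e) g) → IA B e → RidgeData
    case-remove EA⊆cl ia = record
      { J = K - e ; B′ = B ; J-indep = Ind-⊆ K-e⊆K IK ; rbJ = rbJ ; J≢K = J≢K
      ; J≤K = inj₂ ((B , rbJ , rbK) , K-e⊆K) ; K-e⊆J = x∈p∧x≢y⇒x∈p-y ; e∉J = e∉K-e ; J<e⊆K = λ u∈ _ → K-e⊆K u∈
      ; EA-J⊆EA-K = EA-J⊆EA-K ; EA-K⊆J∪EA-J = λ ea → EA-survives x∈p∧x≢y⇒x∈p-y ea (EA⊆cl ea)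
      ; B-K⊆B′-J = λ g∈B g∉K → g∈B , g∉K ∘ K-e⊆K }
      where
        K-e⊆K : K - e ⊆ K
        K-e⊆K = p─q⊆p K _
        e∉K-e : e ∉ K - e
        e∉K-e e∈ = proj₂ (x∈p-y⁻ e∈) refl
        J≢K : K - e ≢ K
        J≢K eq = e∉K-e (subst (e ∈_) (sym eq) e∈K)
        rbJ : RB (K - e) B
        rbJ = B-basis , K⊆B ∘ K-e⊆K , still-active
          where
            still-active : ∀ u → u ∈ B → u ∉ K - e → IntActive Ind B u
            still-active u u∈B u∉ with u ≟ᶠ e
            ... | yes refl = IA⇒IntActive ia
            ... | no u≢e = proj₂ (proj₂ rbK) u u∈B (u∉ ∘ (λ u∈K → x∈p∧x≢y⇒x∈p-y u∈K u≢e))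
        EA-J⊆EA-K : ∀ {g} → EA (K - e) g → EA K g
        EA-J⊆EA-K ea = EA-outside-K x∈p∧x≢y⇒x∈p-y (λ u∈ _ → K-e⊆K u∈) ea , Cl-mono (below-mono K-e⊆K) (proj₂ ea)

    module Swap (f : Fin n) (e<f : e <ᶠ f) (¬Cl-f : ¬ Cl (B - e) f) where

      swap : Subset n → Subset n
      swap S = (S - e) ∪ ⁅ f ⁆

      swap⁻ : ∀ {S u} → u ∈ swap S → (u ∈ S × u ≢ e) ⊎ u ≡ f
      swap⁻ = Data.Sum.map₁ x∈p-y⁻ ∘ x∈p∪⁅y⁆⁻

      swap⁺ : ∀ {S u} → u ∈ S → u ≢ e → u ∈ swap S
      swap⁺ u∈S u≢e = p⊆p∪⁅y⁆ (x∈p∧x≢y⇒x∈p-y u∈S u≢e)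

      J B′ : Subset n
      J = swap K
      B′ = swap B

      f∉B : f ∉ B
      f∉B f∈B = ¬Cl-f (∈⇒Cl (x∈p∧x≢y⇒x∈p-y f∈B (<ᶠ⇒≢ e<f ∘ sym)))

      f∈J : f ∈ J
      f∈J = y∈p∪⁅y⁆

      e∉J : e ∉ J
      e∉J e∈J = [ (λ { (_ , e≢e) → e≢e refl }) , <ᶠ⇒≢ e<f ] (swap⁻ e∈J)

      J<e⊆K : ∀ {u} → u ∈ J → u <ᶠ e → u ∈ K
      J<e⊆K u∈J u<e = [ proj₁ , (λ { refl → ⊥-elim (<ᶠ-irrefl refl (<ᶠ-trans u<e e<f)) }) ] (swap⁻ u∈J)

      swap-indep : ∀ {S} → S ⊆ B → Ind S → Ind (swap S)
      swap-indep {S} S⊆B IS = ¬Cl⇒indep∪⁅⁆ (Ind-⊆ (p─q⊆p S _) IS)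
                                (¬Cl-f ∘ Cl-mono (p⊆q⇒p-y⊆q-y S⊆B))

      B′-basis : IsBasis Ind B′
      B′-basis = spanning⇒basis (swap-indep id (proj₁ B-basis)) λ g → Cl-trans B⊆clB′ (B-spanning g)
        where
          B⊆clB′ : ∀ {t} → t ∈ B → Cl B′ t
          B⊆clB′ {t} t∈B with t ≟ᶠ e
          ... | yes refl = Cl-exchange (Cl-mono p⊆p-y∪⁅y⁆ (B-spanning f)) ¬Cl-f
          ... | no t≢e = ∈⇒Cl (swap⁺ t∈B t≢e)

      B-K⊆B′-J : ∀ {g} → g ∈ B → g ∉ K → g ∈ B′ × g ∉ J
      B-K⊆B′-J g∈B g∉K = swap⁺ g∈B (λ { refl → g∉K e∈K }) , [ g∉K ∘ proj₁ , (λ { refl → f∉B g∈B }) ] ∘ swap⁻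

      swap-ridge-data : (∀ {u} → u ∈ B → u ≢ e → u ∉ K → ¬ Cl (restAbove B u) u → ¬ Cl (restAbove B′ u) u) →
                        (∀ {g} → EA J g → EA K g) →
                        (∀ {g} → EA K g → g ∈ J ⊎ EA J g) →
                        (∀ {g} → g ∈ J → Cl (restAbove J g) g → (g ∈ K × Cl (restAbove K g) g) ⊎ EA K g) →
                        RidgeData
      swap-ridge-data IA-transfer EA-J⊆EA-K EA-K⊆J∪EA-J passive-transfer = record
        { J = J ; B′ = B′ ; J-indep = J-indep ; rbJ = rbJ ; J≢K = λ J≡K → f∉B (K⊆B (subst (f ∈_) J≡K f∈J))
        ; J≤K = inj₁ (not-related
                     , λ g → InL⁺ IK ∘ [ uncurry passive-transfer , inj₂ ∘ EA-J⊆EA-K ] ∘ InL⁻ J-indep)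
        ; K-e⊆J = swap⁺ ; e∉J = e∉J ; J<e⊆K = J<e⊆K
        ; EA-J⊆EA-K = EA-J⊆EA-K ; EA-K⊆J∪EA-J = EA-K⊆J∪EA-J ; B-K⊆B′-J = B-K⊆B′-J }
        where
          J-indep : Ind J
          J-indep = swap-indep K⊆B IK
          rbJ : RB J B′
          rbJ = B′-basis , swap-mono , active
            where
              swap-mono : J ⊆ B′
              swap-mono = ∪⁅⁆-monoˡ (p⊆q⇒p-y⊆q-y K⊆B)
              active : ∀ u → u ∈ B′ → u ∉ J → IntActive Ind B′ u
              active u u∈B′ u∉J with swap⁻ u∈B′
              ... | inj₂ refl = ⊥-elim (u∉J f∈J)
              ... | inj₁ (u∈B , u≢e) = IA⇒IntActive (u∈B′ , IA-transfer u∈B u≢e u∉K active-in-B)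
                where
                  u∉K : u ∉ K
                  u∉K = u∉J ∘ λ u∈K → swap⁺ u∈K u≢e
                  active-in-B : ¬ Cl (restAbove B u) u
                  active-in-B = proj₂ (IntActive⇒IA (proj₂ (proj₂ rbK) u u∈B u∉K))
          not-related : ¬ InternallyRelated Ind J K
          not-related (_ , rbJ′ , rbK′) =
            f∉B (subst (f ∈_) (trans (related-basis-unique rbJ rbJ′) (related-basis-unique rbK′ rbK)) y∈p∪⁅y⁆)

    case-least-EA : ∀ {f} → EA K f → ¬ Cl (K - e) f → (∀ v → v <ᶠ f → ¬ (EA K v × ¬ Cl (K - e) v)) → RidgeData
    case-least-EA {f} ea-f@(_ , cl-f) ¬cl-f least =
      swap-ridge-data IA-transfer EA-J⊆EA-K EA-K⊆J∪EA-J passive-transfer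
      where
        e<f : e <ᶠ f
        e<f = decidable-stable (e <?ᶠ f) λ e≮f →
          ¬cl-f (Cl-mono (λ u∈ → x∈p∧x≢y⇒x∈p-y (below-⊆ u∈) λ { refl → e≮f (proj₂ (below⁻ u∈)) }) cl-f)
        e-spanned : Cl ((below K f - e) ∪ ⁅ f ⁆) e
        e-spanned = Cl-exchange (Cl-mono p⊆p-y∪⁅y⁆ cl-f) (¬cl-f ∘ Cl-mono (p⊆q⇒p-y⊆q-y below-⊆))
        ¬Cl-B-e-f : ¬ Cl (B - e) f
        ¬Cl-B-e-f cl = ¬Cl-B-e (Cl-trans span e-spanned)
          where
            span : ∀ {t} → t ∈ (below K f - e) ∪ ⁅ f ⁆ → Cl (B - e) t
            span t∈ with x∈p∪⁅y⁆⁻ t∈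
            ... | inj₁ t∈′ = ∈⇒Cl (p⊆q⇒p-y⊆q-y (K⊆B ∘ below-⊆) t∈′)
            ... | inj₂ refl = cl
        open Swap f e<f ¬Cl-B-e-f

        IA-transfer : ∀ {u} → u ∈ B → u ≢ e → u ∉ K → ¬ Cl (restAbove B u) u → ¬ Cl (restAbove B′ u) u
        IA-transfer {u} u∈B u≢e u∉K ¬cl = ¬cl ∘ Cl-trans span
          where
            span : ∀ {t} → t ∈ restAbove B′ u → Cl (restAbove B u) t
            span t∈ with restAbove⁻ t∈
            ... | inj₂ u<t = ∈⇒Cl (restAbove⁺ (inj₂ u<t))
            ... | inj₁ (t∈B′ , t≢u) with swap⁻ t∈B′
            ...   | inj₁ (t∈B , _) = ∈⇒Cl (restAbove⁺ (inj₁ (t∈B , t≢u)))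
            ...   | inj₂ refl =
              Cl-mono (λ v∈ → restAbove⁺ (inj₁ (K⊆B (below-⊆ v∈) , λ { refl → u∉K (below-⊆ v∈) }))) cl-f

        EA-J⊆EA-K : ∀ {g} → EA J g → EA K g
        EA-J⊆EA-K {g} ea = EA-outside-K swap⁺ J<e⊆K ea , Cl-trans span (proj₂ ea)
          where
            span : ∀ {t} → t ∈ below J g → Cl (below K g) t
            span t∈ with swap⁻ (below-⊆ t∈)
            ... | inj₁ (t∈K , _) = ∈⇒Cl (below⁺ t∈K (proj₂ (below⁻ t∈)))
            ... | inj₂ refl = Cl-mono (below-monoʳ (proj₂ (below⁻ t∈))) cl-f

        EA-K⊆J∪EA-J : ∀ {g} → EA K g → g ∈ J ⊎ EA J g
        EA-K⊆J∪EA-J {g} ea with Cl? (K - e) g | g ≟ᶠ f | g ∈? J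
        ... | yes cl | _ | _ = EA-survives swap⁺ ea cl
        ... | no _ | yes refl | _ = inj₁ f∈J
        ... | no _ | no _ | yes g∈J = inj₁ g∈J
        ... | no ¬cl | no g≢f | no g∉J = inj₂ (g∉J , Cl-trans span (proj₂ ea))
          where
            f<g : f <ᶠ g
            f<g = ≤∧≢⇒<ᶠ (≮⇒≥ λ g<f → least g g<f (ea , ¬cl)) (g≢f ∘ sym)
            span : ∀ {t} → t ∈ below K g → Cl (below J g) t
            span {t} t∈ with t ≟ᶠ e
            ... | no t≢e = ∈⇒Cl (below⁺ (swap⁺ (below-⊆ t∈) t≢e) (proj₂ (below⁻ t∈)))
            ... | yes refl = Cl-mono below-f⊆ e-spanned
              where
                below-f⊆ : (below K f - e) ∪ ⁅ f ⁆ ⊆ below J g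
                below-f⊆ = ∪⁅⁆-least (λ v∈ → below⁺ (swap⁺ (below-⊆ (proj₁ (x∈p-y⁻ v∈))) (proj₂ (x∈p-y⁻ v∈)))
                                                    (<ᶠ-trans (proj₂ (below⁻ (proj₁ (x∈p-y⁻ v∈)))) f<g))
                                     (below⁺ f∈J f<g)

        passive-transfer : ∀ {g} → g ∈ J → Cl (restAbove J g) g → (g ∈ K × Cl (restAbove K g) g) ⊎ EA K g
        passive-transfer {g} g∈J cl with g ≟ᶠ f | swap⁻ g∈J
        ... | yes refl | _ = inj₂ ea-f
        ... | no g≢f | inj₂ g≡f = ⊥-elim (g≢f g≡f)
        ... | no g≢f | inj₁ (g∈K , _) = inj₁ (g∈K , Cl-trans span cl)
          where
            span : ∀ {t} → t ∈ restAbove J g → Cl (restAbove K g) t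
            span t∈ with restAbove⁻ t∈
            ... | inj₂ g<t = ∈⇒Cl (restAbove⁺ (inj₂ g<t))
            ... | inj₁ (t∈J , t≢g) with swap⁻ t∈J
            ...   | inj₁ (t∈K , _) = ∈⇒Cl (restAbove⁺ (inj₁ (t∈K , t≢g)))
            ...   | inj₂ refl with <-cmp f g
            ...     | tri< f<g _ _ =
              Cl-mono (λ v∈ → restAbove⁺ (inj₁ (below-⊆ v∈ , <ᶠ⇒≢ (<ᶠ-trans (proj₂ (below⁻ v∈)) f<g)))) cl-f
            ...     | tri≈ _ f≡g _ = ⊥-elim (t≢g f≡g)
            ...     | tri> _ _ g<f = ∈⇒Cl (restAbove⁺ (inj₂ g<f))

    case-greatest-unspanned : (∀ {g} → EA K g → Cl (K - e) g) → ¬ IA B e → RidgeData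
    case-greatest-unspanned EA⊆cl ¬ia =
      [ (λ none → ⊥-elim (¬Cl-B-e (Cl-trans (span none) (decidable-stable (Cl? _ _) (¬ia ∘ (K⊆B e∈K ,_))))))
      , (λ { (f , (e<f , ¬cl-f) , greatest) → swap-greatest f e<f ¬cl-f greatest }) ]′
      (search-greatest (λ h → (e <?ᶠ h) ×-dec ¬? (Cl? (B - e) h)))
      where
        span : (∀ h → ¬ (e <ᶠ h × ¬ Cl (B - e) h)) → ∀ {t} → t ∈ restAbove B e → Cl (B - e) t
        span none {t} t∈ with restAbove⁻ t∈
        ... | inj₁ (t∈B , t≢e) = ∈⇒Cl (x∈p∧x≢y⇒x∈p-y t∈B t≢e)
        ... | inj₂ e<t = decidable-stable (Cl? _ _) λ ¬cl → none t (e<t , ¬cl)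

        swap-greatest : ∀ f → e <ᶠ f → ¬ Cl (B - e) f → (∀ h → f <ᶠ h → ¬ (e <ᶠ h × ¬ Cl (B - e) h)) →
                        RidgeData
        swap-greatest f e<f ¬cl-f greatest =
          swap-ridge-data IA-transfer EA-J⊆EA-K (λ ea → EA-survives swap⁺ ea (EA⊆cl ea)) passive-transfer
          where
            open Swap f e<f ¬cl-f

            above-f-spanned : ∀ {h} → f <ᶠ h → Cl (B - e) h
            above-f-spanned {h} f<h = decidable-stable (Cl? _ _) λ ¬cl → greatest h f<h (<ᶠ-trans e<f f<h , ¬cl)

            swap-keeps-active : ∀ {S a} → S ⊆ B → a ∈ B → a ≢ e → f <ᶠ a →
                                ¬ Cl (restAbove S a) a → ¬ Cl (restAbove (swap S) a) a
            swap-keeps-active {S} {a} S⊆B a∈B a≢e f<a ¬cl cl =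
              ¬cl-f (Cl-trans span′ (Cl-exchange (Cl-mono ⊆X∪f cl) (¬cl ∘ Cl-mono (restAbove-mono (p─q⊆p S _)))))
              where
                ⊆X∪f : restAbove (swap S) a ⊆ restAbove (S - e) a ∪ ⁅ f ⁆
                ⊆X∪f t∈ with restAbove⁻ t∈
                ... | inj₂ a<t = p⊆p∪⁅y⁆ (restAbove⁺ (inj₂ a<t))
                ... | inj₁ (t∈swap , t≢a) with swap⁻ t∈swap
                ...   | inj₁ (t∈S , t≢e) = p⊆p∪⁅y⁆ (restAbove⁺ (inj₁ (x∈p∧x≢y⇒x∈p-y t∈S t≢e , t≢a)))
                ...   | inj₂ refl = y∈p∪⁅y⁆
                span′ : ∀ {t} → t ∈ restAbove (S - e) a ∪ ⁅ a ⁆ → Cl (B - e) t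
                span′ t∈ with x∈p∪⁅y⁆⁻ t∈
                ... | inj₂ refl = ∈⇒Cl (x∈p∧x≢y⇒x∈p-y a∈B a≢e)
                ... | inj₁ t∈X with restAbove⁻ t∈X
                ...   | inj₁ (t∈S-e , _) = ∈⇒Cl (p⊆q⇒p-y⊆q-y S⊆B t∈S-e)
                ...   | inj₂ a<t = above-f-spanned (<ᶠ-trans f<a a<t)

            swap-below-f : ∀ {S a} → a <ᶠ f → restAbove (swap S) a ⊆ restAbove S a
            swap-below-f a<f t∈ with restAbove⁻ t∈
            ... | inj₂ a<t = restAbove⁺ (inj₂ a<t)
            ... | inj₁ (t∈swap , t≢a) with swap⁻ t∈swap
            ...   | inj₁ (t∈S , _) = restAbove⁺ (inj₁ (t∈S , t≢a))
            ...   | inj₂ refl = restAbove⁺ (inj₂ a<f)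

            IA-transfer : ∀ {u} → u ∈ B → u ≢ e → u ∉ K → ¬ Cl (restAbove B u) u → ¬ Cl (restAbove B′ u) u
            IA-transfer {u} u∈B u≢e _ ¬cl with <-cmp f u
            ... | tri< f<u _ _ = swap-keeps-active id u∈B u≢e f<u ¬cl
            ... | tri≈ _ refl _ = ⊥-elim (f∉B u∈B)
            ... | tri> _ _ u<f = ¬cl ∘ Cl-mono (swap-below-f u<f)

            EA-J⊆EA-K : ∀ {g} → EA J g → EA K g
            EA-J⊆EA-K {g} ea@(g∉J , cl) = EA-outside-K swap⁺ J<e⊆K ea , decidable-stable (Cl? _ _) ¬¬cl
              where
                ¬¬cl : ¬ ¬ Cl (below K g) g
                ¬¬cl ¬cl with <-cmp g f
                ... | tri≈ _ refl _ = g∉J f∈J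
                ... | tri< g<f _ _ = ¬cl (Cl-mono below-J⊆ cl)
                  where
                    below-J⊆ : below J g ⊆ below K g
                    below-J⊆ t∈ with swap⁻ (below-⊆ t∈)
                    ... | inj₁ (t∈K , _) = below⁺ t∈K (proj₂ (below⁻ t∈))
                    ... | inj₂ refl = ⊥-elim (<ᶠ-irrefl refl (<ᶠ-trans g<f (proj₂ (below⁻ t∈))))
                ... | tri> _ _ f<g =
                  ¬cl-f (Cl-trans span′ (Cl-exchange (Cl-mono below-J⊆ cl) (¬cl ∘ Cl-mono (p─q⊆p _ _))))
                  where
                    below-J⊆ : below J g ⊆ (below K g - e) ∪ ⁅ f ⁆
                    below-J⊆ t∈ with swap⁻ (below-⊆ t∈)
                    ... | inj₁ (t∈K , t≢e) = p⊆p∪⁅y⁆ (x∈p∧x≢y⇒x∈p-y (below⁺ t∈K (proj₂ (below⁻ t∈))) t≢e)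
                    ... | inj₂ refl = y∈p∪⁅y⁆
                    span′ : ∀ {t} → t ∈ (below K g - e) ∪ ⁅ g ⁆ → Cl (B - e) t
                    span′ t∈ with x∈p∪⁅y⁆⁻ t∈
                    ... | inj₁ t∈′ = ∈⇒Cl (p⊆q⇒p-y⊆q-y (K⊆B ∘ below-⊆) t∈′)
                    ... | inj₂ refl = above-f-spanned f<g

            passive-transfer : ∀ {g} → g ∈ J → Cl (restAbove J g) g → (g ∈ K × Cl (restAbove K g) g) ⊎ EA K g
            passive-transfer {g} g∈J cl with g ≟ᶠ f | swap⁻ g∈J
            ... | yes refl | _ = ⊥-elim (¬cl-f (Cl-trans span′ cl))
              where
                span′ : ∀ {t} → t ∈ restAbove J f → Cl (B - e) t
                span′ t∈ with restAbove⁻ t∈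
                ... | inj₂ f<t = above-f-spanned f<t
                ... | inj₁ (t∈J , t≢f) with swap⁻ t∈J
                ...   | inj₁ (t∈K , t≢e) = ∈⇒Cl (x∈p∧x≢y⇒x∈p-y (K⊆B t∈K) t≢e)
                ...   | inj₂ t≡f = ⊥-elim (t≢f t≡f)
            ... | no g≢f | inj₂ g≡f = ⊥-elim (g≢f g≡f)
            ... | no g≢f | inj₁ (g∈K , g≢e) with <-cmp f g
            ...   | tri< f<g _ _ =
              inj₁ (g∈K , decidable-stable (Cl? _ _) λ ¬cl → swap-keeps-active K⊆B (K⊆B g∈K) g≢e f<g ¬cl cl)
            ...   | tri≈ _ f≡g _ = ⊥-elim (g≢f (sym f≡g))
            ...   | tri> _ _ g<f = inj₁ (g∈K , Cl-mono (swap-below-f g<f) cl)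

    ridge-data : RidgeData
    ridge-data = [ (λ none → from-IA (EA⊆cl none) (IA? B e))
                 , (λ { (f , (ea , ¬cl) , least) → case-least-EA ea ¬cl least }) ]′
                (search-least (λ g → EA? K g ×-dec ¬? (Cl? (K - e) g)))
      where
        EA⊆cl : (∀ g → ¬ (EA K g × ¬ Cl (K - e) g)) → ∀ {g} → EA K g → Cl (K - e) g
        EA⊆cl none {g} ea = decidable-stable (Cl? _ _) λ ¬cl → none g (ea , ¬cl)
        from-IA : (∀ {g} → EA K g → Cl (K - e) g) → Dec (IA B e) → RidgeData
        from-IA EA⊆cl′ (yes ia) = case-remove EA⊆cl′ ia
        from-IA EA⊆cl′ (no ¬ia) = case-greatest-unspanned EA⊆cl′ ¬ia

  ridge : ∀ {K e} → Ind K → e ∈ K → Ridge K e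
  ridge IK e∈K = ridge-from ridge-data
    where open RidgeAt IK e∈K (proj₂ (related-basis IK))

  ⊆∪EA-or-witness : ∀ I K → (∀ {e} → e ∈ K → e ∈ I ⊎ EA I e) ⊎ ∃[ e ] (e ∈ K × e ∉ I × ¬ EA I e)
  ⊆∪EA-or-witness I K with any? (λ e → (e ∈? K) ×-dec (¬? (e ∈? I) ×-dec ¬? (EA? I e)))
  ... | yes witness = inj₂ witness
  ... | no none = inj₁ λ {e} e∈K →
    Data.Sum.map₂ (λ e∉I → decidable-stable (EA? I e) λ ¬ea → none (e , e∈K , e∉I , ¬ea)) (toSum (e ∈? I))

  ridge-step : ∀ {I K e} → Ind I → e ∈ K → e ∉ I → ¬ EA I e → (r : Ridge K e) →
               ShellingStep (Facet Ind I) (Facet Ind (Ridge.J r)) (Facet Ind K) (z e)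
  ridge-step II e∈K e∉I ¬ea r = shelling-step (inj₁ e∈K) ([ e∉I , ¬ea ] ∘ Facet-z⁻ II) z∉FJ FK⊆FJ
    where open Ridge r

  earlier-ridge : ∀ {L : List (Subset n)} → EnumeratesIndep Ind L → IsLinearExtension Ind L → ∀ i k → i <ᶠ k →
    ∃[ j ] ∃[ v ] (j <ᶠ k × ShellingStep (Facet Ind (lookup L i)) (Facet Ind (lookup L j))
                                        (Facet Ind (lookup L k)) v)
  earlier-ridge {L} (_ , enumerates) linear i k i<k = [ not-covered , covered ]′ (⊆∪EA-or-witness I K)
    where
      I K : Subset n
      I = lookup L i
      K = lookup L k
      indep-at : ∀ i → Ind (lookup L i)
      indep-at i = proj₂ (enumerates _) (∈-lookup i)
      Goal : Set
      Goal = ∃[ j ] ∃[ v ] (j <ᶠ k × ShellingStep (Facet Ind I) (Facet Ind (lookup L j)) (Facet Ind K) v)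
      not-covered : (∀ {e} → e ∈ K → e ∈ I ⊎ EA I e) → Goal
      not-covered K⊆I∪EA = ⊥-elim (<⇒≱ i<k (linear k i (⊆∪EA⇒ExtIntLe (indep-at i) K⊆I∪EA (indep-at k))))
      covered : ∃[ e ] (e ∈ K × e ∉ I × ¬ EA I e) → Goal
      covered (e , e∈K , e∉I , ¬ea) =
        j , z e , j<k , subst (λ J → ShellingStep _ (Facet Ind J) _ _) J≡ (ridge-step (indep-at i) e∈K e∉I ¬ea r)
        where
          r : Ridge K e
          r = ridge (indep-at k) e∈K
          J∈L : Ridge.J r ∈ˡ L
          J∈L = proj₁ (enumerates (Ridge.J r)) (Ridge.J-indep r)
          j : Fin (length L)
          j = Any.index J∈L
          J≡ : Ridge.J r ≡ lookup L j
          J≡ = lookup-index J∈L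
          j<k : j <ᶠ k
          j<k = ≤∧≢⇒<ᶠ (linear j k (subst (λ J → ExtIntLe Ind J _) J≡ (Ridge.J≤K r)))
                       (λ j≡k → Ridge.J≢K r (trans J≡ (cong (lookup L) j≡k)))

theorem5p7 : (n : ℕ) (M : Matroid n) (L : List (Subset n)) →
    EnumeratesIndep (Indep M) L →
    IsLinearExtension (Indep M) L →
    IsShellingOrder (map (Facet (Indep M)) L)
theorem5p7 n M L enumerates linear =
  shelling-from-positions (Facet (Indep M)) L (earlier-ridge enumerates linear)
  where open Shelling M
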